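{- There is an absolute constant $C>0$ such that the following holds. Let $q\geq 3$ be prime, $n\geq1$, $G=\mathbb{F}_q^n$, let $p\geq 1$ be an integer, and let $A\subset G$ be nonempty with density $\alpha$ and $\|\mu_A\circ\mu_A\|_p\geq 1+2^{ -3}$. Then there is a parameter $\sigma\in[1+2^{ -3},\alpha^{ -1}]$ and there are sets $A_1,A_2\subset G$, each of density at least $\alpha^{C(p+\mathcal{L}(\alpha))}$ in $G$, such that, setting $S=\{x\in G:\mu_A\circ\mu_A(x)\geq(1-2^{ -7})\sigma\}$, \[\langle \mathds{1}_S,\mu_{A_1}\circ\mu_{A_2}\rangle\geq 1-2^{ -7},\] and for each $i\in\{1,2\}$, \[\langle\mu_A\circ\mu_A,\mu_{A_i}\circ\mu_{A_i}\rangle\leq 2\sigma.\]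
   Context: For $f,g:G\to\mathbb{R}$: $\mathbb{E}_x f(x)=|G|^{ -1}\sum_{x\in G}f(x)$, $\langle f,g\rangle=\mathbb{E}_x f(x)g(x)$, $f\circ g(x)=\mathbb{E}_y f(y)g(x+y)$, $\|f\|_p=(\mathbb{E}_x|f(x)|^p)^{1/p}$. For nonempty $X\subset G$, $\mu_X=\frac{|G|}{|X|}\mathds{1}_X$; density of $X$ is $|X|/|G|$. $\mathcal{L}(\alpha)=\log(2/\alpha)$. -}

module Defs where

open import Data.Bool using (Bool; true; false; if_then_else_)
open import Data.Nat as ℕ using (ℕ; zero; suc; _∸_)
open import Data.Nat.DivMod using (_mod_)
open import Data.Nat.Logarithm using (⌈log₂_⌉)
open import Data.Fin using (Fin; toℕ)
open import Data.Vec using (Vec; []; _∷_; zipWith)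
open import Data.List using (List; []; _∷_; map; concatMap; foldr)
open import Data.List.Base using () renaming ([] to nil)
open import Data.Fin.Base using ()
open import Data.Integer using (+_)
open import Data.Rational using (ℚ; 0ℚ; 1ℚ; _+_; _*_; _/_)

G : ℕ → ℕ → Set
G q n = Vec (Fin q) n

addF : {q : ℕ} → Fin q → Fin q → Fin q
addF {suc k} a b = (toℕ a ℕ.+ toℕ b) mod (suc k)

_⊕_ : {q n : ℕ} → G q n → G q n → G q n
x ⊕ y = zipWith addF x y

allFin : (q : ℕ) → List (Fin q)
allFin zero = []
allFin (suc q) = Fin.zero ∷ map Fin.suc (allFin q)

elems : (q n : ℕ) → List (G q n)
elems q zero = [] ∷ []
elems q (suc n) = concatMap (λ i → map (i ∷_) (elems q n)) (allFin q)

size : ℕ → ℕ → ℕ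
size q n = q ℕ.^ n

-- a / b as a rational, with the (unused) convention a / 0 = 0
frac : ℕ → ℕ → ℚ
frac a zero = 0ℚ
frac a (suc b) = (+ a) / suc b

sumQ : List ℚ → ℚ
sumQ = foldr _+_ 0ℚ

𝔼 : {q n : ℕ} → (G q n → ℚ) → ℚ
𝔼 {q} {n} f = frac 1 (size q n) * sumQ (map f (elems q n))

Subset : ℕ → ℕ → Set
Subset q n = G q n → Bool

card : {q n : ℕ} → Subset q n → ℕ
card {q} {n} X = foldr (λ x k → if X x then suc k else k) 0 (elems q n)

density : {q n : ℕ} → Subset q n → ℚ
density {q} {n} X = frac (card X) (size q n)

𝟙 : {q n : ℕ} → Subset q n → G q n → ℚ
𝟙 X x = if X x then 1ℚ else 0ℚ

-- μ_X = (|G|/|X|) 𝟙_X   (only used for nonempty X)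
μ : {q n : ℕ} → Subset q n → G q n → ℚ
μ {q} {n} X x = if X x then frac (size q n) (card X) else 0ℚ

_⊚_ : {q n : ℕ} → (G q n → ℚ) → (G q n → ℚ) → G q n → ℚ
(f ⊚ g) x = 𝔼 (λ y → f y * g (x ⊕ y))

⟨_,_⟩ : {q n : ℕ} → (G q n → ℚ) → (G q n → ℚ) → ℚ
⟨ f , g ⟩ = 𝔼 (λ x → f x * g x)

_^_ : ℚ → ℕ → ℚ
r ^ zero = 1ℚ
r ^ suc k = r * (r ^ k)

-- 𝔼_x f(x)^p ; for f ≥ 0 this is ‖f‖_p^p
powMean : {q n : ℕ} → (G q n → ℚ) → ℕ → ℚ
powMean f p = 𝔼 (λ x → f x ^ p)

-- ⌈log₂ (2/α)⌉ for α = |A|/|G|, computed as ⌈log₂ ⌈2|G|/|A|⌉⌉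
-- (2^k ≥ x ⇔ 2^k ≥ ⌈x⌉ since 2^k is an integer).
Lceil : {q n : ℕ} → Subset q n → ℕ
Lceil {q} {n} A with card A
... | zero = 0
... | suc a = ⌈log₂ ((2 ℕ.* size q n ℕ.+ a) ℕ./ suc a) ⌉

module Submission where

-- Write f = μ_A ∘ μ_A = (|G|/|A|²) rep_A, where rep_A z counts the y ∈ A with z + y ∈ A, and let
-- M_j = Σ_z rep_A(z)^j.  The sequence M is log-convex, so the ratios M_{j+1}/M_j increase with j.
-- The hypothesis ‖f‖_p ≥ 9/8 puts M_p/M_{p−1} above (9/8)|A|²/|G|, and every ratio is at most |A|;
-- hence among 256·𝓛 consecutive windows of length m = 2048 starting at p − 1, in one of them the ratio
-- grows by a factor at most 257/256.  Let j be the right end of that window and σ = |G| M_{j+1}/(|A|² M_j).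
-- Log-convexity across the window shows that the z with f(z) < (127/128)σ carry at most 2⁻⁹ of M_j.
-- Finally, for a j-tuple s let A_s = ⋂_{t ∈ s} (A − t): summed over all tuples, |A_s| totals |G||A|^j
-- and rep_{A_s}(z) totals |G| rep_A(z)^j, so averaging yields an s for which A_s is dense, μ_{A_s} ∘ μ_{A_s}
-- puts almost all its mass on popular differences, and ⟨f, μ_{A_s} ∘ μ_{A_s}⟩ ≤ 2σ.  Take A₁ = A₂ = A_s.

module ListSum where

  open import Data.Bool using (Bool; true; false; _∧_; not)
  open import Data.List using (List; []; _∷_; map; concatMap; length; _++_)
  open import Data.Nat using (ℕ; z≤n; s≤s; _+_; _*_; _≤_; _<_)
  open import Data.Nat.ListAction using (sum)
  open import Data.Nat.Properties
  open import Algebra.Properties.CommutativeSemigroup +-commutativeSemigroup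
    using () renaming (interchange to +-interchange)
  open import Data.Product using (∃-syntax; _,_)
  open import Relation.Binary.PropositionalEquality
  open import Relation.Nullary using (yes; no)

  ⟦_⟧ : Bool → ℕ
  ⟦ true ⟧ = 1
  ⟦ false ⟧ = 0

  ⟦⟧≤1 : ∀ b → ⟦ b ⟧ ≤ 1
  ⟦⟧≤1 true = s≤s z≤n
  ⟦⟧≤1 false = z≤n

  ⟦∧⟧ : ∀ b c → ⟦ b ∧ c ⟧ ≡ ⟦ b ⟧ * ⟦ c ⟧
  ⟦∧⟧ true c = sym (+-identityʳ ⟦ c ⟧)
  ⟦∧⟧ false c = refl

  ⟦⟧+⟦not⟧ : ∀ b x → ⟦ b ⟧ * x + ⟦ not b ⟧ * x ≡ x
  ⟦⟧+⟦not⟧ true x = trans (+-identityʳ (x + 0)) (+-identityʳ x)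
  ⟦⟧+⟦not⟧ false x = +-identityʳ x

  module _ {A : Set} where

    ∑ : List A → (A → ℕ) → ℕ
    ∑ xs f = sum (map f xs)

    ∑-cong : ∀ xs {f g : A → ℕ} → (∀ x → f x ≡ g x) → ∑ xs f ≡ ∑ xs g
    ∑-cong [] _ = refl
    ∑-cong (x ∷ xs) f≡g = cong₂ _+_ (f≡g x) (∑-cong xs f≡g)

    ∑-mono-≤ : ∀ xs {f g : A → ℕ} → (∀ x → f x ≤ g x) → ∑ xs f ≤ ∑ xs g
    ∑-mono-≤ [] _ = z≤n
    ∑-mono-≤ (x ∷ xs) f≤g = +-mono-≤ (f≤g x) (∑-mono-≤ xs f≤g)

    ∑-distrib-+ : ∀ xs (f g : A → ℕ) → ∑ xs (λ x → f x + g x) ≡ ∑ xs f + ∑ xs g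
    ∑-distrib-+ [] f g = refl
    ∑-distrib-+ (x ∷ xs) f g =
      trans (cong (f x + g x +_) (∑-distrib-+ xs f g)) (+-interchange (f x) (g x) (∑ xs f) (∑ xs g))

    ∑-*ˡ : ∀ xs c (f : A → ℕ) → ∑ xs (λ x → c * f x) ≡ c * ∑ xs f
    ∑-*ˡ [] c f = sym (*-zeroʳ c)
    ∑-*ˡ (x ∷ xs) c f = trans (cong (c * f x +_) (∑-*ˡ xs c f)) (sym (*-distribˡ-+ c (f x) (∑ xs f)))

    ∑-*ʳ : ∀ xs c (f : A → ℕ) → ∑ xs (λ x → f x * c) ≡ ∑ xs f * c
    ∑-*ʳ xs c f = trans (∑-cong xs (λ x → *-comm (f x) c)) (trans (∑-*ˡ xs c f) (*-comm c (∑ xs f)))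

    ∑-const : ∀ xs c → ∑ xs (λ _ → c) ≡ length xs * c
    ∑-const [] c = refl
    ∑-const (x ∷ xs) c = cong (c +_) (∑-const xs c)

    ∑-++ : ∀ xs ys (f : A → ℕ) → ∑ (xs ++ ys) f ≡ ∑ xs f + ∑ ys f
    ∑-++ [] ys f = refl
    ∑-++ (x ∷ xs) ys f = trans (cong (f x +_) (∑-++ xs ys f)) (sym (+-assoc (f x) (∑ xs f) (∑ ys f)))

    ∑<∑⇒∃< : ∀ xs (f g : A → ℕ) → ∑ xs f < ∑ xs g → ∃[ x ] f x < g x
    ∑<∑⇒∃< (x ∷ xs) f g ∑f<∑g with f x <? g x
    ... | yes fx<gx = x , fx<gx
    ... | no fx≮gx = ∑<∑⇒∃< xs f g
      (+-cancelˡ-< (f x) _ _ (<-≤-trans ∑f<∑g (+-monoˡ-≤ (∑ xs g) (≮⇒≥ fx≮gx))))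

  module _ {A B : Set} where

    ∑-map : ∀ xs (k : A → B) (f : B → ℕ) → ∑ (map k xs) f ≡ ∑ xs (λ x → f (k x))
    ∑-map [] k f = refl
    ∑-map (x ∷ xs) k f = cong (f (k x) +_) (∑-map xs k f)

    ∑-concatMap : ∀ xs (k : A → List B) (f : B → ℕ) → ∑ (concatMap k xs) f ≡ ∑ xs (λ x → ∑ (k x) f)
    ∑-concatMap [] k f = refl
    ∑-concatMap (x ∷ xs) k f = trans (∑-++ (k x) (concatMap k xs) f) (cong (∑ (k x) f +_) (∑-concatMap xs k f))

    ∑-comm : ∀ xs ys (h : A → B → ℕ) → ∑ xs (λ x → ∑ ys (h x)) ≡ ∑ ys (λ y → ∑ xs (λ x → h x y))
    ∑-comm [] ys h = sym (trans (∑-const ys 0) (*-zeroʳ (length ys)))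
    ∑-comm (x ∷ xs) ys h = trans (cong (∑ ys (h x) +_) (∑-comm xs ys h)) (sym (∑-distrib-+ ys (h x) _))

module NatLemmas where

  open import Data.Nat using (zero; suc; z<s; _*_; _^_; _≤_; _<_; >-nonZero)
  open import Data.Nat.Properties using (*-cancelʳ-≤; *-commutativeSemigroup)
  open import Algebra.Properties.CommutativeSemigroup *-commutativeSemigroup
    using () renaming (interchange to *-interchange)
  open import Relation.Binary.PropositionalEquality

  *-pos : ∀ {x y} → 0 < x → 0 < y → 0 < x * y
  *-pos {suc x} {suc y} _ _ = z<s

  ^-pos : ∀ {x} n → 0 < x → 0 < x ^ n
  ^-pos zero _ = z<s
  ^-pos (suc n) x>0 = *-pos x>0 (^-pos n x>0)

  *-cancelʳ-≤-pos : ∀ {m n} o → 0 < o → m * o ≤ n * o → m ≤ n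
  *-cancelʳ-≤-pos {m} {n} o o>0 = *-cancelʳ-≤ m n o {{>-nonZero o>0}}

  ^-distribʳ-* : ∀ x y n → (x * y) ^ n ≡ x ^ n * y ^ n
  ^-distribʳ-* x y zero = refl
  ^-distribʳ-* x y (suc n) = trans (cong (x * y *_) (^-distribʳ-* x y n)) (*-interchange x y (x ^ n) (y ^ n))

module GroupSums where

  open import Defs hiding (_^_)
  open ListSum
  open NatLemmas using (^-pos)
  open import Algebra.Properties.CommutativeMonoid.Sum as CMSum using ()
  open import Data.Bool using (true; false; if_then_else_)
  open import Data.Fin as Fin using (Fin; toℕ)
  open import Data.Fin.Permutation using (Permutation; permutation)
  open import Data.Fin.Properties using (toℕ-fromℕ<; toℕ-injective; toℕ<n)
  open import Data.List using ([]; _∷_; map; length; foldr)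
  open import Data.List.Properties using (length-map)
  open import Data.Nat using (ℕ; zero; suc; z<s; _+_; _*_; _∸_; _%_; _<_)
  open import Data.Nat.DivMod using (_mod_; %-distribˡ-+; m%n%n≡m%n; [m+n]%n≡m%n; m<n⇒m%n≡m)
  open import Data.Nat.Properties
  open import Data.Vec using ([]; _∷_)
  open import Relation.Binary.PropositionalEquality
  open ≡-Reasoning

  module _ {k : ℕ} where
    private
      q : ℕ
      q = suc k

    toℕ-addF : (a b : Fin q) → toℕ (addF a b) ≡ (toℕ a + toℕ b) % q
    toℕ-addF a b = toℕ-fromℕ< _

    %-absorbˡ : ∀ x y → (x % q + y) % q ≡ (x + y) % q
    %-absorbˡ x y = begin
      (x % q + y) % q           ≡⟨ %-distribˡ-+ (x % q) y q ⟩
      (x % q % q + y % q) % q   ≡⟨ cong (λ z → (z + y % q) % q) (m%n%n≡m%n x q) ⟩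
      (x % q + y % q) % q       ≡⟨ %-distribˡ-+ x y q ⟨
      (x + y) % q               ∎

    %-absorbʳ : ∀ x y → (x + y % q) % q ≡ (x + y) % q
    %-absorbʳ x y = begin
      (x + y % q) % q   ≡⟨ cong (_% q) (+-comm x (y % q)) ⟩
      (y % q + x) % q   ≡⟨ %-absorbˡ y x ⟩
      (y + x) % q       ≡⟨ cong (_% q) (+-comm y x) ⟩
      (x + y) % q       ∎

    addF-comm : (a b : Fin q) → addF a b ≡ addF b a
    addF-comm a b = toℕ-injective (begin
      toℕ (addF a b)          ≡⟨ toℕ-addF a b ⟩
      (toℕ a + toℕ b) % q     ≡⟨ cong (_% q) (+-comm (toℕ a) (toℕ b)) ⟩
      (toℕ b + toℕ a) % q     ≡⟨ toℕ-addF b a ⟨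
      toℕ (addF b a)          ∎)

    addF-assoc : (a b c : Fin q) → addF (addF a b) c ≡ addF a (addF b c)
    addF-assoc a b c = toℕ-injective (begin
      toℕ (addF (addF a b) c)                ≡⟨ toℕ-addF (addF a b) c ⟩
      (toℕ (addF a b) + toℕ c) % q           ≡⟨ cong (λ z → (z + toℕ c) % q) (toℕ-addF a b) ⟩
      ((toℕ a + toℕ b) % q + toℕ c) % q      ≡⟨ %-absorbˡ (toℕ a + toℕ b) (toℕ c) ⟩
      (toℕ a + toℕ b + toℕ c) % q            ≡⟨ cong (_% q) (+-assoc (toℕ a) (toℕ b) (toℕ c)) ⟩
      (toℕ a + (toℕ b + toℕ c)) % q          ≡⟨ %-absorbʳ (toℕ a) (toℕ b + toℕ c) ⟨
      (toℕ a + (toℕ b + toℕ c) % q) % q      ≡⟨ cong (λ z → (toℕ a + z) % q) (toℕ-addF b c) ⟨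
      (toℕ a + toℕ (addF b c)) % q           ≡⟨ toℕ-addF a (addF b c) ⟨
      toℕ (addF a (addF b c))                ∎)

    negF : Fin q → Fin q
    negF a = (q ∸ toℕ a) mod q

    toℕ-negF : (a : Fin q) → toℕ (negF a) ≡ (q ∸ toℕ a) % q
    toℕ-negF a = toℕ-fromℕ< _

    negF-inverseˡ : (a b : Fin q) → addF (negF a) (addF a b) ≡ b
    negF-inverseˡ a b = toℕ-injective (begin
      toℕ (addF (negF a) (addF a b))                  ≡⟨ toℕ-addF (negF a) (addF a b) ⟩
      (toℕ (negF a) + toℕ (addF a b)) % q             ≡⟨ cong₂ (λ u v → (u + v) % q) (toℕ-negF a) (toℕ-addF a b) ⟩
      ((q ∸ toℕ a) % q + (toℕ a + toℕ b) % q) % q     ≡⟨ %-absorbˡ (q ∸ toℕ a) _ ⟩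
      (q ∸ toℕ a + (toℕ a + toℕ b) % q) % q           ≡⟨ %-absorbʳ (q ∸ toℕ a) _ ⟩
      (q ∸ toℕ a + (toℕ a + toℕ b)) % q               ≡⟨ cong (_% q) (+-assoc (q ∸ toℕ a) (toℕ a) (toℕ b)) ⟨
      (q ∸ toℕ a + toℕ a + toℕ b) % q                 ≡⟨ cong (λ z → (z + toℕ b) % q) (m∸n+n≡m (<⇒≤ (toℕ<n a))) ⟩
      (q + toℕ b) % q                                 ≡⟨ cong (_% q) (+-comm q (toℕ b)) ⟩
      (toℕ b + q) % q                                 ≡⟨ [m+n]%n≡m%n (toℕ b) q ⟩
      toℕ b % q                                       ≡⟨ m<n⇒m%n≡m (toℕ<n b) ⟩
      toℕ b                                           ∎)

    negF-inverseʳ : (a b : Fin q) → addF a (addF (negF a) b) ≡ b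
    negF-inverseʳ a b = begin
      addF a (addF (negF a) b)    ≡⟨ addF-assoc a (negF a) b ⟨
      addF (addF a (negF a)) b    ≡⟨ cong (λ z → addF z b) (addF-comm a (negF a)) ⟩
      addF (addF (negF a) a) b    ≡⟨ addF-assoc (negF a) a b ⟩
      addF (negF a) (addF a b)    ≡⟨ negF-inverseˡ a b ⟩
      b                           ∎

    translation : Fin q → Permutation q q
    translation j = permutation (addF j) (addF (negF j)) (negF-inverseʳ j) (negF-inverseˡ j)

  ∑-allFin : ∀ {m} (h : Fin m → ℕ) → ∑ (allFin m) h ≡ CMSum.sum +-0-commutativeMonoid h
  ∑-allFin {zero} h = refl
  ∑-allFin {suc m} h = cong (h Fin.zero +_) (trans (∑-map (allFin m) Fin.suc h) (∑-allFin (λ i → h (Fin.suc i))))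

  ∑-allFin-translate : ∀ {k} (j : Fin (suc k)) (h : Fin (suc k) → ℕ) →
                       ∑ (allFin (suc k)) (λ i → h (addF j i)) ≡ ∑ (allFin (suc k)) h
  ∑-allFin-translate j h = begin
    ∑ (allFin _) (λ i → h (addF j i))                        ≡⟨ ∑-allFin (λ i → h (addF j i)) ⟩
    CMSum.sum +-0-commutativeMonoid (λ i → h (addF j i))     ≡⟨ CMSum.sum-permute +-0-commutativeMonoid h (translation j) ⟨
    CMSum.sum +-0-commutativeMonoid h                        ≡⟨ ∑-allFin h ⟨
    ∑ (allFin _) h                                           ∎

  length-allFin : ∀ m → length (allFin m) ≡ m
  length-allFin zero = refl
  length-allFin (suc m) = cong suc (trans (length-map Fin.suc (allFin m)) (length-allFin m))

  ∑-elems-suc : ∀ q n (f : G q (suc n) → ℕ) →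
                ∑ (elems q (suc n)) f ≡ ∑ (allFin q) (λ i → ∑ (elems q n) (λ x → f (i ∷ x)))
  ∑-elems-suc q n f = trans (∑-concatMap (allFin q) (λ i → map (i ∷_) (elems q n)) f)
                            (∑-cong (allFin q) (λ i → ∑-map (elems q n) (i ∷_) f))

  ∑-elems-const : ∀ q n c → ∑ (elems q n) (λ _ → c) ≡ size q n * c
  ∑-elems-const q zero c = refl
  ∑-elems-const q (suc n) c = begin
    ∑ (elems q (suc n)) (λ _ → c)                   ≡⟨ ∑-elems-suc q n (λ _ → c) ⟩
    ∑ (allFin q) (λ _ → ∑ (elems q n) (λ _ → c))    ≡⟨ ∑-cong (allFin q) (λ _ → ∑-elems-const q n c) ⟩
    ∑ (allFin q) (λ _ → size q n * c)               ≡⟨ ∑-const (allFin q) (size q n * c) ⟩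
    length (allFin q) * (size q n * c)              ≡⟨ cong (_* (size q n * c)) (length-allFin q) ⟩
    q * (size q n * c)                              ≡⟨ *-assoc q (size q n) c ⟨
    size q (suc n) * c                              ∎

  size>0 : ∀ {k n} → 0 < size (suc k) n
  size>0 {k} {n} = ^-pos n z<s

  card≡∑ : ∀ {q n} (X : Subset q n) → card X ≡ ∑ (elems q n) (λ x → ⟦ X x ⟧)
  card≡∑ {q} {n} X = go (elems q n)
    where
    go : ∀ xs → foldr (λ x k → if X x then suc k else k) 0 xs ≡ ∑ xs (λ x → ⟦ X x ⟧)
    go [] = refl
    go (x ∷ xs) with X x
    ... | true = cong suc (go xs)
    ... | false = go xs

  module _ {k : ℕ} where
    private
      q : ℕ
      q = suc k

    ⊕-comm : ∀ {n} (x y : G q n) → x ⊕ y ≡ y ⊕ x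
    ⊕-comm [] [] = refl
    ⊕-comm (a ∷ x) (b ∷ y) = cong₂ _∷_ (addF-comm a b) (⊕-comm x y)

    ⊕-assoc : ∀ {n} (x y z : G q n) → (x ⊕ y) ⊕ z ≡ x ⊕ (y ⊕ z)
    ⊕-assoc [] [] [] = refl
    ⊕-assoc (a ∷ x) (b ∷ y) (c ∷ z) = cong₂ _∷_ (addF-assoc a b c) (⊕-assoc x y z)

    ∑-translate : ∀ n (y : G q n) (g : G q n → ℕ) → ∑ (elems q n) (λ t → g (y ⊕ t)) ≡ ∑ (elems q n) g
    ∑-translate zero [] g = refl
    ∑-translate (suc n) (j ∷ y) g = begin
      ∑ (elems q (suc n)) (λ t → g ((j ∷ y) ⊕ t))                          ≡⟨ ∑-elems-suc q n _ ⟩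
      ∑ (allFin q) (λ i → ∑ (elems q n) (λ x → g (addF j i ∷ (y ⊕ x))))   ≡⟨ ∑-cong (allFin q) (λ i → ∑-translate n y (λ x → g (addF j i ∷ x))) ⟩
      ∑ (allFin q) (λ i → ∑ (elems q n) (λ x → g (addF j i ∷ x)))         ≡⟨ ∑-allFin-translate j (λ i → ∑ (elems q n) (λ x → g (i ∷ x))) ⟩
      ∑ (allFin q) (λ i → ∑ (elems q n) (λ x → g (i ∷ x)))                ≡⟨ ∑-elems-suc q n g ⟨
      ∑ (elems q (suc n)) g                                               ∎

    ∑-translateʳ : ∀ n (y : G q n) (g : G q n → ℕ) → ∑ (elems q n) (λ t → g (t ⊕ y)) ≡ ∑ (elems q n) g
    ∑-translateʳ n y g = trans (∑-cong (elems q n) (λ t → cong g (⊕-comm t y))) (∑-translate n y g)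

module Moments where

  open ListSum
  open NatLemmas
  open import Data.Bool using (Bool; true; false)
  open import Data.List using (List; []; _∷_)
  open import Data.Nat using (ℕ; zero; suc; z≤n; z<s; s≤s⁻¹; _+_; _*_; _^_; _∸_; _≤_; _<_; _≤?_; >-nonZero)
  open import Data.Nat.Properties
  open import Data.Nat.Tactic.RingSolver using (solve; solve-∀)
  open import Algebra.Properties.CommutativeSemigroup *-commutativeSemigroup
    using (x∙yz≈y∙xz; xy∙z≈y∙xz; xy∙z≈xz∙y; x∙yz≈xz∙y; xy∙z≈yz∙x; x∙yz≈xy∙z)
  open import Data.Empty using (⊥-elim)
  open import Data.Product using (∃-syntax; _×_; _,_)
  open import Data.Sum using (_⊎_; inj₁; inj₂)
  open import Relation.Binary.PropositionalEquality
  open import Relation.Nullary using (Dec; yes; no)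
  open ≤-Reasoning

  private
    rearrangement-≤ : ∀ {x y} d → x ≤ y → x * y ^ d + y * x ^ d ≤ y ^ suc d + x ^ suc d
    rearrangement-≤ {x} {y} d x≤y =
      subst₂ (λ Y y → x * Y + y * x ^ d ≤ y * Y + x * x ^ d)
             (m+[n∸m]≡n (^-monoˡ-≤ d x≤y)) (m+[n∸m]≡n x≤y) (excess x (y ∸ x) (x ^ d) (y ^ d ∸ x ^ d))
      where
      excess : ∀ x e X f → x * (X + f) + (x + e) * X ≤ (x + e) * (X + f) + x * X
      excess x e X f = begin
        x * (X + f) + (x + e) * X           ≤⟨ m≤m+n _ (e * f) ⟩
        x * (X + f) + (x + e) * X + e * f   ≡⟨ solve (x ∷ e ∷ X ∷ f ∷ []) ⟩
        (x + e) * (X + f) + x * X           ∎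

  rearrangement : ∀ x y d → x * y ^ d + y * x ^ d ≤ y ^ suc d + x ^ suc d
  rearrangement x y d with ≤-total x y
  ... | inj₁ x≤y = rearrangement-≤ d x≤y
  ... | inj₂ y≤x = subst₂ _≤_ (+-comm (y * x ^ d) _) (+-comm (x ^ suc d) _) (rearrangement-≤ d y≤x)

  rearrangement-scaled : ∀ x y i d → x ^ suc i * y ^ (i + d) + y ^ suc i * x ^ (i + d)
                                     ≤ x ^ i * y ^ suc (i + d) + y ^ i * x ^ suc (i + d)
  rearrangement-scaled x y i d = begin
    x ^ suc i * y ^ (i + d) + y ^ suc i * x ^ (i + d)
      ≡⟨ cong₂ (λ Y X → x ^ suc i * Y + y ^ suc i * X) (^-distribˡ-+-* y i d) (^-distribˡ-+-* x i d) ⟩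
    x * x ^ i * (y ^ i * y ^ d) + y * y ^ i * (x ^ i * x ^ d)
      ≡⟨ factor (x ^ i) (y ^ i) x y (x ^ d) (y ^ d) ⟩
    x ^ i * y ^ i * (x * y ^ d + y * x ^ d)
      ≤⟨ *-monoʳ-≤ (x ^ i * y ^ i) (rearrangement x y d) ⟩
    x ^ i * y ^ i * (y * y ^ d + x * x ^ d)
      ≡⟨ factor′ (x ^ i) (y ^ i) x y (x ^ d) (y ^ d) ⟨
    x ^ i * (y * (y ^ i * y ^ d)) + y ^ i * (x * (x ^ i * x ^ d))
      ≡⟨ cong₂ (λ Y X → x ^ i * (y * Y) + y ^ i * (x * X)) (^-distribˡ-+-* y i d) (^-distribˡ-+-* x i d) ⟨
    x ^ i * y ^ suc (i + d) + y ^ i * x ^ suc (i + d)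
      ∎
    where
    factor : ∀ P Q x y X Y → x * P * (Q * Y) + y * Q * (P * X) ≡ P * Q * (x * Y + y * X)
    factor = solve-∀
    factor′ : ∀ P Q x y X Y → P * (y * (Q * Y)) + Q * (x * (P * X)) ≡ P * Q * (y * Y + x * X)
    factor′ = solve-∀

  moment : ∀ {A : Set} → List A → (A → ℕ) → ℕ → ℕ
  moment xs F j = ∑ xs (λ z → F z ^ j)

  LogConvex : (ℕ → ℕ) → Set
  LogConvex M = ∀ {i j} → i ≤ j → M (suc i) * M j ≤ M i * M (suc j)

  module _ {A : Set} (F : A → ℕ) where

    private
      expand : ∀ a b c d → (a + b) * (c + d) ≡ a * c + (a * d + b * c) + b * d
      expand = solve-∀

      cross-terms : ∀ xs v i d →
        v ^ suc i * moment xs F (i + d) + moment xs F (suc i) * v ^ (i + d)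
        ≤ v ^ i * moment xs F (suc (i + d)) + moment xs F i * v ^ suc (i + d)
      cross-terms xs v i d = begin
        v ^ suc i * moment xs F (i + d) + moment xs F (suc i) * v ^ (i + d)
          ≡⟨ cong₂ _+_ (∑-*ˡ xs (v ^ suc i) _) (∑-*ʳ xs (v ^ (i + d)) _) ⟨
        ∑ xs (λ z → v ^ suc i * F z ^ (i + d)) + ∑ xs (λ z → F z ^ suc i * v ^ (i + d))
          ≡⟨ ∑-distrib-+ xs _ _ ⟨
        ∑ xs (λ z → v ^ suc i * F z ^ (i + d) + F z ^ suc i * v ^ (i + d))
          ≤⟨ ∑-mono-≤ xs (λ z → rearrangement-scaled v (F z) i d) ⟩
        ∑ xs (λ z → v ^ i * F z ^ suc (i + d) + F z ^ i * v ^ suc (i + d))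
          ≡⟨ ∑-distrib-+ xs _ _ ⟩
        ∑ xs (λ z → v ^ i * F z ^ suc (i + d)) + ∑ xs (λ z → F z ^ i * v ^ suc (i + d))
          ≡⟨ cong₂ _+_ (∑-*ˡ xs (v ^ i) _) (∑-*ʳ xs (v ^ suc (i + d)) _) ⟩
        v ^ i * moment xs F (suc (i + d)) + moment xs F i * v ^ suc (i + d)
          ∎

      moment-logConvex′ : ∀ xs i d → moment xs F (suc i) * moment xs F (i + d) ≤ moment xs F i * moment xs F (suc (i + d))
      moment-logConvex′ [] i d = z≤n
      moment-logConvex′ (x ∷ xs) i d = begin
        (v ^ suc i + M (suc i)) * (v ^ (i + d) + M (i + d))
          ≡⟨ expand (v ^ suc i) (M (suc i)) (v ^ (i + d)) (M (i + d)) ⟩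
        v ^ suc i * v ^ (i + d) + (v ^ suc i * M (i + d) + M (suc i) * v ^ (i + d)) + M (suc i) * M (i + d)
          ≤⟨ +-mono-≤ (+-monoʳ-≤ (v ^ suc i * v ^ (i + d)) (cross-terms xs v i d)) (moment-logConvex′ xs i d) ⟩
        v ^ suc i * v ^ (i + d) + (v ^ i * M (suc (i + d)) + M i * v ^ suc (i + d)) + M i * M (suc (i + d))
          ≡⟨ cong (λ t → t + (v ^ i * M (suc (i + d)) + M i * v ^ suc (i + d)) + M i * M (suc (i + d)))
                  (xy∙z≈y∙xz v (v ^ i) (v ^ (i + d))) ⟩
        v ^ i * v ^ suc (i + d) + (v ^ i * M (suc (i + d)) + M i * v ^ suc (i + d)) + M i * M (suc (i + d))
          ≡⟨ expand (v ^ i) (M i) (v ^ suc (i + d)) (M (suc (i + d))) ⟨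
        (v ^ i + M i) * (v ^ suc (i + d) + M (suc (i + d)))
          ∎
        where
        v : ℕ
        v = F x
        M : ℕ → ℕ
        M = moment xs F

    moment-logConvex : ∀ xs → LogConvex (moment xs F)
    moment-logConvex xs {i} i≤j = subst (λ j → moment xs F (suc i) * moment xs F j ≤ moment xs F i * moment xs F (suc j))
                                        (m+[n∸m]≡n i≤j) (moment-logConvex′ xs i _)

    moment-suc-≤ : ∀ xs {a} → (∀ z → F z ≤ a) → ∀ j → moment xs F (suc j) ≤ a * moment xs F j
    moment-suc-≤ xs {a} F≤a j = begin
      moment xs F (suc j)          ≤⟨ ∑-mono-≤ xs (λ z → *-monoˡ-≤ (F z ^ j) (F≤a z)) ⟩
      ∑ xs (λ z → a * F z ^ j)     ≡⟨ ∑-*ˡ xs a _ ⟩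
      a * moment xs F j            ∎

    moment-pos : ∀ xs → 0 < ∑ xs F → ∀ j → 0 < moment xs F j
    moment-pos (x ∷ xs) ∑F>0 j with F x
    ... | zero = ≤-trans (moment-pos xs ∑F>0 j) (m≤n+m _ _)
    ... | suc w = ≤-trans (^-pos j z<s) (m≤m+n _ _)

    tail-moment-≤ : ∀ xs (bad : A → Bool) {c d Q T k m} → (∀ z → bad z ≡ true → d * F z * Q ≤ c * T) →
                    ∑ xs (λ z → ⟦ bad z ⟧ * F z ^ (k + m)) * (d * Q) ^ m ≤ (c * T) ^ m * moment xs F k
    tail-moment-≤ xs bad {c} {d} {Q} {T} {k} {m} bad⇒small = begin
      ∑ xs (λ z → ⟦ bad z ⟧ * F z ^ (k + m)) * (d * Q) ^ m      ≡⟨ ∑-*ʳ xs ((d * Q) ^ m) _ ⟨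
      ∑ xs (λ z → ⟦ bad z ⟧ * F z ^ (k + m) * (d * Q) ^ m)      ≤⟨ ∑-mono-≤ xs pointwise ⟩
      ∑ xs (λ z → (c * T) ^ m * F z ^ k)                         ≡⟨ ∑-*ˡ xs ((c * T) ^ m) _ ⟩
      (c * T) ^ m * moment xs F k                                ∎
      where
      regroup : ∀ x y w → 1 * (x * y) * w ≡ x * (y * w)
      regroup = solve-∀
      pointwise : ∀ z → ⟦ bad z ⟧ * F z ^ (k + m) * (d * Q) ^ m ≤ (c * T) ^ m * F z ^ k
      pointwise z with bad z in is-bad
      ... | false = z≤n
      ... | true = begin
        1 * F z ^ (k + m) * (d * Q) ^ m         ≡⟨ cong (λ x → 1 * x * (d * Q) ^ m) (^-distribˡ-+-* (F z) k m) ⟩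
        1 * (F z ^ k * F z ^ m) * (d * Q) ^ m   ≡⟨ regroup (F z ^ k) (F z ^ m) ((d * Q) ^ m) ⟩
        F z ^ k * (F z ^ m * (d * Q) ^ m)       ≡⟨ cong (F z ^ k *_) (^-distribʳ-* (F z) (d * Q) m) ⟨
        F z ^ k * (F z * (d * Q)) ^ m           ≡⟨ cong (λ x → F z ^ k * x ^ m) (x∙yz≈xy∙z (F z) d Q) ⟩
        F z ^ k * (F z * d * Q) ^ m             ≡⟨ cong (λ x → F z ^ k * (x * Q) ^ m) (*-comm (F z) d) ⟩
        F z ^ k * (d * F z * Q) ^ m             ≤⟨ *-monoʳ-≤ (F z ^ k) (^-monoˡ-≤ m (bad⇒small z is-bad)) ⟩
        F z ^ k * (c * T) ^ m                   ≡⟨ *-comm (F z ^ k) ((c * T) ^ m) ⟩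
        (c * T) ^ m * F z ^ k                   ∎

    tail-moment-bound : ∀ xs (bad : A → Bool) {c d u v Q T k m} → 0 < Q →
      (∀ z → bad z ≡ true → d * F z * Q ≤ c * T) →
      (u * T) ^ m * moment xs F k ≤ (v * Q) ^ m * Q →
      ∑ xs (λ z → ⟦ bad z ⟧ * F z ^ (k + m)) * (d * u) ^ m ≤ (c * v) ^ m * Q
    tail-moment-bound xs bad {c} {d} {u} {v} {Q} {T} {k} {m} Q>0 bad⇒small window =
      *-cancelʳ-≤-pos (Q ^ m) (^-pos m Q>0) (begin
        tail * (d * u) ^ m * Q ^ m                 ≡⟨ cong (λ x → tail * x * Q ^ m) (^-distribʳ-* d u m) ⟩
        tail * (d ^ m * u ^ m) * Q ^ m             ≡⟨ regroupˡ tail (d ^ m) (u ^ m) (Q ^ m) ⟩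
        tail * (d ^ m * Q ^ m) * u ^ m             ≡⟨ cong (λ x → tail * x * u ^ m) (^-distribʳ-* d Q m) ⟨
        tail * (d * Q) ^ m * u ^ m                 ≤⟨ *-monoˡ-≤ (u ^ m) (tail-moment-≤ xs bad {c} {d} {Q} {T} {k} {m} bad⇒small) ⟩
        (c * T) ^ m * moment xs F k * u ^ m        ≡⟨ cong (λ x → x * moment xs F k * u ^ m) (^-distribʳ-* c T m) ⟩
        c ^ m * T ^ m * moment xs F k * u ^ m      ≡⟨ regroupᵐ (c ^ m) (T ^ m) (moment xs F k) (u ^ m) ⟩
        c ^ m * (u ^ m * T ^ m * moment xs F k)    ≡⟨ cong (λ x → c ^ m * (x * moment xs F k)) (^-distribʳ-* u T m) ⟨
        c ^ m * ((u * T) ^ m * moment xs F k)      ≤⟨ *-monoʳ-≤ (c ^ m) window ⟩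
        c ^ m * ((v * Q) ^ m * Q)                  ≡⟨ cong (λ x → c ^ m * (x * Q)) (^-distribʳ-* v Q m) ⟩
        c ^ m * (v ^ m * Q ^ m * Q)                ≡⟨ regroupʳ (c ^ m) (v ^ m) (Q ^ m) Q ⟩
        c ^ m * v ^ m * Q * Q ^ m                  ≡⟨ cong (λ x → x * Q * Q ^ m) (^-distribʳ-* c v m) ⟨
        (c * v) ^ m * Q * Q ^ m                    ∎)
      where
      tail : ℕ
      tail = ∑ xs (λ z → ⟦ bad z ⟧ * F z ^ (k + m))
      regroupˡ : ∀ t x y z → t * (x * y) * z ≡ t * (x * z) * y
      regroupˡ = solve-∀
      regroupᵐ : ∀ c t μ u → c * t * μ * u ≡ c * (u * t * μ)
      regroupᵐ = solve-∀
      regroupʳ : ∀ c v x q → c * (v * x * q) ≡ c * v * q * x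
      regroupʳ = solve-∀

  module LogConvexSequence (M : ℕ → ℕ) (M-pos : ∀ j → 0 < M j) (logConvex : LogConvex M) where

    ratio-mono : ∀ {c d i j} → i ≤ j → c * M i ≤ d * M (suc i) → c * M j ≤ d * M (suc j)
    ratio-mono {c} {d} {i} {j} i≤j ratio-at-i = *-cancelʳ-≤-pos (M i) (M-pos i) (begin
      c * M j * M i             ≡⟨ xy∙z≈xz∙y c (M j) (M i) ⟩
      c * M i * M j             ≤⟨ *-monoˡ-≤ (M j) ratio-at-i ⟩
      d * M (suc i) * M j       ≡⟨ *-assoc d (M (suc i)) (M j) ⟩
      d * (M (suc i) * M j)     ≤⟨ *-monoʳ-≤ d (logConvex i≤j) ⟩
      d * (M i * M (suc j))     ≡⟨ x∙yz≈xz∙y d (M i) (M (suc j)) ⟩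
      d * M (suc j) * M i       ∎)

    power-mean : ∀ k → M 0 * M 1 ^ k ≤ M 0 ^ k * M k
    power-mean zero = ≤-reflexive (trans (*-identityʳ (M 0)) (sym (*-identityˡ (M 0))))
    power-mean (suc k) = begin
      M 0 * (M 1 * M 1 ^ k)        ≡⟨ x∙yz≈y∙xz (M 0) (M 1) (M 1 ^ k) ⟩
      M 1 * (M 0 * M 1 ^ k)        ≤⟨ *-monoʳ-≤ (M 1) (power-mean k) ⟩
      M 1 * (M 0 ^ k * M k)        ≡⟨ x∙yz≈y∙xz (M 1) (M 0 ^ k) (M k) ⟩
      M 0 ^ k * (M 1 * M k)        ≤⟨ *-monoʳ-≤ (M 0 ^ k) (logConvex z≤n) ⟩
      M 0 ^ k * (M 0 * M (suc k))  ≡⟨ x∙yz≈y∙xz (M 0 ^ k) (M 0) (M (suc k)) ⟩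
      M 0 * (M 0 ^ k * M (suc k))  ≡⟨ *-assoc (M 0) (M 0 ^ k) (M (suc k)) ⟨
      M 0 ^ suc k * M (suc k)      ∎

    geometric-bound : ∀ p j → j ≤ suc p → M j * M p ^ j ≤ M 0 * M (suc p) ^ j
    geometric-bound p zero _ = ≤-refl
    geometric-bound p (suc j) j<sp = begin
      M (suc j) * (M p * M p ^ j)          ≡⟨ *-assoc (M (suc j)) (M p) (M p ^ j) ⟨
      M (suc j) * M p * M p ^ j            ≤⟨ *-monoˡ-≤ (M p ^ j) (logConvex (s≤s⁻¹ j<sp)) ⟩
      M j * M (suc p) * M p ^ j            ≡⟨ xy∙z≈y∙xz (M j) (M (suc p)) (M p ^ j) ⟩
      M (suc p) * (M j * M p ^ j)          ≤⟨ *-monoʳ-≤ (M (suc p)) (geometric-bound p j (<⇒≤ j<sp)) ⟩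
      M (suc p) * (M 0 * M (suc p) ^ j)    ≡⟨ x∙yz≈y∙xz (M (suc p)) (M 0) (M (suc p) ^ j) ⟩
      M 0 * M (suc p) ^ suc j              ∎

    ratio-from-power-mean : ∀ c d p → c ^ suc p * M 0 * M 1 ^ suc p ≤ d ^ suc p * M 0 ^ suc p * M (suc p) →
                            c * M 1 * M p ≤ d * M 0 * M (suc p)
    ratio-from-power-mean c d p power-mean-large with c * M 1 * M p ≤? d * M 0 * M (suc p)
    ... | yes ratio-large = ratio-large
    ... | no ratio-small = ⊥-elim (<-irrefl refl (begin-strict
      (d * M 0 * X) ^ P * X            <⟨ *-monoˡ-< X {{>-nonZero (M-pos P)}} (^-monoˡ-< P (≰⇒> ratio-small)) ⟩
      (c * M 1 * Y) ^ P * X            ≡⟨ cong (_* X) (^-distrib₃ c (M 1) Y) ⟩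
      c ^ P * M 1 ^ P * Y ^ P * X      ≡⟨ move-X (c ^ P) (M 1 ^ P) (Y ^ P) X ⟩
      c ^ P * M 1 ^ P * (X * Y ^ P)    ≤⟨ *-monoʳ-≤ (c ^ P * M 1 ^ P) (geometric-bound p P ≤-refl) ⟩
      c ^ P * M 1 ^ P * (M 0 * X ^ P)  ≡⟨ move-M0 (c ^ P) (M 1 ^ P) (M 0) (X ^ P) ⟩
      c ^ P * M 0 * M 1 ^ P * X ^ P    ≤⟨ *-monoˡ-≤ (X ^ P) power-mean-large ⟩
      d ^ P * M 0 ^ P * X * X ^ P      ≡⟨ move-X′ (d ^ P) (M 0 ^ P) X (X ^ P) ⟩
      d ^ P * M 0 ^ P * X ^ P * X      ≡⟨ cong (_* X) (^-distrib₃ d (M 0) X) ⟨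
      (d * M 0 * X) ^ P * X            ∎))
      where
      P X Y : ℕ
      P = suc p
      X = M (suc p)
      Y = M p
      ^-distrib₃ : ∀ x y z → (x * y * z) ^ P ≡ x ^ P * y ^ P * z ^ P
      ^-distrib₃ x y z = trans (^-distribʳ-* (x * y) z P) (cong (_* z ^ P) (^-distribʳ-* x y P))
      move-X : ∀ a b c x → a * b * c * x ≡ a * b * (x * c)
      move-X = solve-∀
      move-M0 : ∀ a b m x → a * b * (m * x) ≡ a * m * b * x
      move-M0 = solve-∀
      move-X′ : ∀ a b x y → a * b * x * y ≡ a * b * y * x
      move-X′ = solve-∀

    SlowWindow : ℕ → ℕ → ℕ → ℕ → Set
    SlowWindow u v m k = u * M (suc (k + m)) * M k ≤ v * M (k + m) * M (suc k)

    slowWindow? : ∀ u v m k → Dec (SlowWindow u v m k)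
    slowWindow? u v m k = u * M (suc (k + m)) * M k ≤? v * M (k + m) * M (suc k)

    slow-window-bound : ∀ {u v m k} → SlowWindow u v m k → (u * M (suc (k + m))) ^ m * M k ≤ (v * M (k + m)) ^ m * M (k + m)
    slow-window-bound {u} {v} {m} {k} slow = telescope m
      where
      U V : ℕ
      U = u * M (suc (k + m))
      V = v * M (k + m)
      telescope : ∀ t → U ^ t * M k ≤ V ^ t * M (k + t)
      telescope zero = ≤-reflexive (cong (λ t → 1 * M t) (sym (+-identityʳ k)))
      telescope (suc t) = begin
        U * U ^ t * M k            ≡⟨ *-assoc U (U ^ t) (M k) ⟩
        U * (U ^ t * M k)          ≤⟨ *-monoʳ-≤ U (telescope t) ⟩
        U * (V ^ t * M (k + t))    ≡⟨ x∙yz≈y∙xz U (V ^ t) (M (k + t)) ⟩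
        V ^ t * (U * M (k + t))    ≤⟨ *-monoʳ-≤ (V ^ t) (ratio-mono {U} {V} (m≤m+n k t) slow) ⟩
        V ^ t * (V * M (suc (k + t)))  ≡⟨ cong (λ j → V ^ t * (V * M j)) (sym (+-suc k t)) ⟩
        V ^ t * (V * M (k + suc t))    ≡⟨ x∙yz≈y∙xz (V ^ t) V (M (k + suc t)) ⟩
        V * (V ^ t * M (k + suc t))    ≡⟨ *-assoc V (V ^ t) (M (k + suc t)) ⟨
        V * V ^ t * M (k + suc t)      ∎

    slow-window-or-growth : ∀ u v m b J →
      (∃[ i ] i < J × SlowWindow u v m (i * m + b)) ⊎ v ^ J * M (J * m + b) * M (suc b) ≤ u ^ J * M (suc (J * m + b)) * M b
    slow-window-or-growth u v m b zero = inj₂ (≤-reflexive (xy∙z≈xz∙y 1 (M b) (M (suc b))))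
    slow-window-or-growth u v m b (suc J) with slow-window-or-growth u v m b J
    ... | inj₁ (i , i<J , slow) = inj₁ (i , m<n⇒m<1+n i<J , slow)
    ... | inj₂ growth with slowWindow? u v m (J * m + b)
    ...   | yes slow = inj₁ (J , n<1+n J , slow)
    ...   | no fast = inj₂ (subst (λ j → v * v ^ J * M j * M (suc b) ≤ u * u ^ J * M (suc j) * M b)
                                  (next-window J m b) growth-step)
      where
      k : ℕ
      k = J * m + b
      next-window : ∀ J m b → J * m + b + m ≡ suc J * m + b
      next-window = solve-∀
      regroupᵛ : ∀ a A x y z w → a * A * x * y * (z * w) ≡ A * z * y * (a * x * w)
      regroupᵛ = solve-∀
      regroupᵘ : ∀ a A x y z w → A * w * y * (a * x * z) ≡ a * A * x * y * (z * w)
      regroupᵘ = solve-∀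
      growth-step : v * v ^ J * M (k + m) * M (suc b) ≤ u * u ^ J * M (suc (k + m)) * M b
      growth-step = *-cancelʳ-≤-pos (M k * M (suc k)) (*-pos (M-pos k) (M-pos (suc k))) (begin
        v * v ^ J * M (k + m) * M (suc b) * (M k * M (suc k))
          ≡⟨ regroupᵛ v (v ^ J) (M (k + m)) (M (suc b)) (M k) (M (suc k)) ⟩
        v ^ J * M k * M (suc b) * (v * M (k + m) * M (suc k))
          ≤⟨ *-mono-≤ growth (<⇒≤ (≰⇒> fast)) ⟩
        u ^ J * M (suc k) * M b * (u * M (suc (k + m)) * M k)
          ≡⟨ regroupᵘ u (u ^ J) (M (suc (k + m))) (M b) (M k) (M (suc k)) ⟩
        u * u ^ J * M (suc (k + m)) * M b * (M k * M (suc k))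
          ∎)

    slow-window-exists : ∀ {u v c d a} m b J → (∀ j → M (suc j) ≤ a * M j) → c * M b ≤ d * M (suc b) →
                         d * a * u ^ J < c * v ^ J → ∃[ i ] i < J × SlowWindow u v m (i * m + b)
    slow-window-exists {u} {v} {c} {d} {a} m b J M-suc-≤ ratio-at-b overshoot
      with slow-window-or-growth u v m b J
    ... | inj₁ slow = slow
    ... | inj₂ growth = ⊥-elim (<⇒≱ overshoot (*-cancelʳ-≤-pos (M b) (M-pos b) (begin
      c * v ^ J * M b        ≡⟨ xy∙z≈xz∙y c (v ^ J) (M b) ⟩
      c * M b * v ^ J        ≤⟨ *-monoˡ-≤ (v ^ J) ratio-at-b ⟩
      d * M (suc b) * v ^ J  ≡⟨ *-assoc d (M (suc b)) (v ^ J) ⟩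
      d * (M (suc b) * v ^ J) ≤⟨ *-monoʳ-≤ d growth-bounded ⟩
      d * (a * u ^ J * M b)  ≡⟨ regroupˡ d a (u ^ J) (M b) ⟩
      d * a * u ^ J * M b    ∎)))
      where
      k : ℕ
      k = J * m + b
      regroupˡ : ∀ d a U x → d * (a * U * x) ≡ d * a * U * x
      regroupˡ = solve-∀
      regroupʳ : ∀ U a x y → U * (a * x) * y ≡ a * U * y * x
      regroupʳ = solve-∀
      growth-bounded : M (suc b) * v ^ J ≤ a * u ^ J * M b
      growth-bounded = *-cancelʳ-≤-pos (M k) (M-pos k) (begin
        M (suc b) * v ^ J * M k        ≡⟨ xy∙z≈yz∙x (M (suc b)) (v ^ J) (M k) ⟩
        v ^ J * M k * M (suc b)        ≤⟨ growth ⟩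
        u ^ J * M (suc k) * M b        ≤⟨ *-monoˡ-≤ (M b) (*-monoʳ-≤ (u ^ J) (M-suc-≤ k)) ⟩
        u ^ J * (a * M k) * M b        ≡⟨ regroupʳ (u ^ J) a (M k) (M b) ⟩
        a * u ^ J * M b * M k          ∎)

module Representations where

  open import Defs hiding (_^_)
  open ListSum
  open GroupSums
  open Moments using (moment)
  open NatLemmas
  open import Data.Bool using (Bool; true; _∧_)
  open import Data.Product using (∃-syntax; _,_)
  open import Function using (_∘_)
  open import Data.List using (List; []; _∷_; map; concatMap)
  open import Data.Nat using (ℕ; zero; suc; z<s; _+_; _*_; _^_; _≤_; _<_)
  open import Data.Nat.Tactic.RingSolver using (solve-∀)
  open import Data.Nat.Properties
  open import Algebra.Properties.CommutativeSemigroup *-commutativeSemigroup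
    using (x∙yz≈y∙xz) renaming (interchange to *-interchange)
  open import Data.Vec using (Vec; []; _∷_)
  open import Relation.Binary.PropositionalEquality

  module _ {k n : ℕ} where

    private
      q : ℕ
      q = suc k
      E : List (G q n)
      E = elems q n
      N : ℕ
      N = size q n
      N>0 : 0 < N
      N>0 = size>0 {k} {n}

    -- rep X z = |{y ∈ X : z + y ∈ X}| = |X|² (μ_X ∘ μ_X)(z) / |G|
    rep : Subset q n → G q n → ℕ
    rep X z = ∑ E (λ y → ⟦ X y ⟧ * ⟦ X (z ⊕ y) ⟧)

    ∑-rep : ∀ X → ∑ E (rep X) ≡ card X * card X
    ∑-rep X = begin
      ∑ E (λ z → ∑ E (λ y → ⟦ X y ⟧ * ⟦ X (z ⊕ y) ⟧))   ≡⟨ ∑-comm E E _ ⟩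
      ∑ E (λ y → ∑ E (λ z → ⟦ X y ⟧ * ⟦ X (z ⊕ y) ⟧))   ≡⟨ ∑-cong E (λ y → ∑-*ˡ E ⟦ X y ⟧ _) ⟩
      ∑ E (λ y → ⟦ X y ⟧ * ∑ E (λ z → ⟦ X (z ⊕ y) ⟧))   ≡⟨ ∑-cong E (λ y → cong (⟦ X y ⟧ *_) (∑-translateʳ n y (λ x → ⟦ X x ⟧))) ⟩
      ∑ E (λ y → ⟦ X y ⟧ * ∑ E (λ x → ⟦ X x ⟧))         ≡⟨ ∑-*ʳ E _ _ ⟩
      ∑ E (λ y → ⟦ X y ⟧) * ∑ E (λ x → ⟦ X x ⟧)         ≡⟨ cong₂ _*_ (card≡∑ X) (card≡∑ X) ⟨
      card X * card X                                   ∎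
      where open ≡-Reasoning

    rep≤card : ∀ X z → rep X z ≤ card X
    rep≤card X z = ≤-trans
      (∑-mono-≤ E (λ y → ≤-trans (*-monoʳ-≤ ⟦ X y ⟧ (⟦⟧≤1 (X (z ⊕ y)))) (≤-reflexive (*-identityʳ _))))
      (≤-reflexive (sym (card≡∑ X)))

    tuples : ∀ j → List (Vec (G q n) j)
    tuples zero = [] ∷ []
    tuples (suc j) = concatMap (λ t → map (t ∷_) (tuples j)) E

    ∏ : ∀ {j} → (G q n → ℕ) → Vec (G q n) j → ℕ
    ∏ g [] = 1
    ∏ g (t ∷ s) = g t * ∏ g s

    ∏-* : ∀ {j} (g h : G q n → ℕ) (s : Vec (G q n) j) → ∏ g s * ∏ h s ≡ ∏ (λ t → g t * h t) s
    ∏-* g h [] = refl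
    ∏-* g h (t ∷ s) = trans (*-interchange (g t) (∏ g s) (h t) (∏ h s)) (cong (g t * h t *_) (∏-* g h s))

    ∑-tuples-∏ : ∀ j (g : G q n → ℕ) → ∑ (tuples j) (∏ g) ≡ ∑ E g ^ j
    ∑-tuples-∏ zero g = refl
    ∑-tuples-∏ (suc j) g = begin
      ∑ (concatMap (λ t → map (t ∷_) (tuples j)) E) (∏ g)   ≡⟨ ∑-concatMap E (λ t → map (t ∷_) (tuples j)) (∏ g) ⟩
      ∑ E (λ t → ∑ (map (t ∷_) (tuples j)) (∏ g))          ≡⟨ ∑-cong E (λ t → ∑-map (tuples j) (t ∷_) (∏ g)) ⟩
      ∑ E (λ t → ∑ (tuples j) (λ s → g t * ∏ g s))         ≡⟨ ∑-cong E (λ t → ∑-*ˡ (tuples j) (g t) (∏ g)) ⟩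
      ∑ E (λ t → g t * ∑ (tuples j) (∏ g))                 ≡⟨ ∑-cong E (λ t → cong (g t *_) (∑-tuples-∏ j g)) ⟩
      ∑ E (λ t → g t * ∑ E g ^ j)                          ≡⟨ ∑-*ʳ E (∑ E g ^ j) g ⟩
      ∑ E g ^ suc j                                        ∎
      where open ≡-Reasoning

    ⋂translates : ∀ {j} → Subset q n → Vec (G q n) j → Subset q n
    ⋂translates A [] x = true
    ⋂translates A (t ∷ s) x = A (x ⊕ t) ∧ ⋂translates A s x

    ⟦⋂translates⟧ : ∀ {j} A (s : Vec (G q n) j) x → ⟦ ⋂translates A s x ⟧ ≡ ∏ (λ t → ⟦ A (x ⊕ t) ⟧) s
    ⟦⋂translates⟧ A [] x = refl
    ⟦⋂translates⟧ A (t ∷ s) x = trans (⟦∧⟧ (A (x ⊕ t)) _) (cong (⟦ A (x ⊕ t) ⟧ *_) (⟦⋂translates⟧ A s x))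

    ∑-tuples-⋂translates : ∀ A j y → ∑ (tuples j) (λ s → ⟦ ⋂translates A s y ⟧) ≡ card A ^ j
    ∑-tuples-⋂translates A j y = begin
      ∑ (tuples j) (λ s → ⟦ ⋂translates A s y ⟧)           ≡⟨ ∑-cong (tuples j) (λ s → ⟦⋂translates⟧ A s y) ⟩
      ∑ (tuples j) (∏ (λ t → ⟦ A (y ⊕ t) ⟧))               ≡⟨ ∑-tuples-∏ j _ ⟩
      ∑ E (λ t → ⟦ A (y ⊕ t) ⟧) ^ j                        ≡⟨ cong (_^ j) (∑-translate n y (λ t → ⟦ A t ⟧)) ⟩
      ∑ E (λ t → ⟦ A t ⟧) ^ j                              ≡⟨ cong (_^ j) (card≡∑ A) ⟨
      card A ^ j                                           ∎
      where open ≡-Reasoning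

    ∑-tuples-rep : ∀ A j y z →
      ∑ (tuples j) (λ s → ⟦ ⋂translates A s y ⟧ * ⟦ ⋂translates A s (z ⊕ y) ⟧) ≡ rep A z ^ j
    ∑-tuples-rep A j y z = begin
      ∑ (tuples j) (λ s → ⟦ ⋂translates A s y ⟧ * ⟦ ⋂translates A s (z ⊕ y) ⟧)
        ≡⟨ ∑-cong (tuples j) (λ s → cong₂ _*_ (⟦⋂translates⟧ A s y) (⟦⋂translates⟧ A s (z ⊕ y))) ⟩
      ∑ (tuples j) (λ s → ∏ (λ t → ⟦ A (y ⊕ t) ⟧) s * ∏ (λ t → ⟦ A ((z ⊕ y) ⊕ t) ⟧) s)
        ≡⟨ ∑-cong (tuples j) (∏-* _ _) ⟩
      ∑ (tuples j) (∏ (λ t → ⟦ A (y ⊕ t) ⟧ * ⟦ A ((z ⊕ y) ⊕ t) ⟧))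
        ≡⟨ ∑-tuples-∏ j _ ⟩
      ∑ E (λ t → ⟦ A (y ⊕ t) ⟧ * ⟦ A ((z ⊕ y) ⊕ t) ⟧) ^ j
        ≡⟨ cong (_^ j) (∑-cong E (λ t → cong (λ x → ⟦ A (y ⊕ t) ⟧ * ⟦ A x ⟧) (⊕-assoc z y t))) ⟩
      ∑ E (λ t → ⟦ A (y ⊕ t) ⟧ * ⟦ A (z ⊕ (y ⊕ t)) ⟧) ^ j
        ≡⟨ cong (_^ j) (∑-translate n y (λ t → ⟦ A t ⟧ * ⟦ A (z ⊕ t) ⟧)) ⟩
      rep A z ^ j
        ∎
      where open ≡-Reasoning

    ∑-tuples-card : ∀ A j → ∑ (tuples j) (λ s → card (⋂translates A s)) ≡ N * card A ^ j
    ∑-tuples-card A j = begin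
      ∑ (tuples j) (λ s → card (⋂translates A s))                      ≡⟨ ∑-cong (tuples j) (λ s → card≡∑ (⋂translates A s)) ⟩
      ∑ (tuples j) (λ s → ∑ E (λ y → ⟦ ⋂translates A s y ⟧))          ≡⟨ ∑-comm (tuples j) E _ ⟩
      ∑ E (λ y → ∑ (tuples j) (λ s → ⟦ ⋂translates A s y ⟧))          ≡⟨ ∑-cong E (∑-tuples-⋂translates A j) ⟩
      ∑ E (λ _ → card A ^ j)                                           ≡⟨ ∑-elems-const q n (card A ^ j) ⟩
      N * card A ^ j                                                   ∎
      where open ≡-Reasoning

    ∑-tuples-weighted-rep : ∀ A j (h : G q n → ℕ) →
      ∑ (tuples j) (λ s → ∑ E (λ z → h z * rep (⋂translates A s) z)) ≡ N * ∑ E (λ z → h z * rep A z ^ j)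
    ∑-tuples-weighted-rep A j h = begin
      ∑ (tuples j) (λ s → ∑ E (λ z → h z * rep (⋂translates A s) z))   ≡⟨ ∑-comm (tuples j) E _ ⟩
      ∑ E (λ z → ∑ (tuples j) (λ s → h z * rep (⋂translates A s) z))   ≡⟨ ∑-cong E (λ z → ∑-*ˡ (tuples j) (h z) _) ⟩
      ∑ E (λ z → h z * ∑ (tuples j) (λ s → rep (⋂translates A s) z))   ≡⟨ ∑-cong E (λ z → cong (h z *_) (∑-comm (tuples j) E _)) ⟩
      ∑ E (λ z → h z * ∑ E (λ y → ∑ (tuples j) (λ s → ⟦ ⋂translates A s y ⟧ * ⟦ ⋂translates A s (z ⊕ y) ⟧)))
        ≡⟨ ∑-cong E (λ z → cong (h z *_) (∑-cong E (λ y → ∑-tuples-rep A j y z))) ⟩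
      ∑ E (λ z → h z * ∑ E (λ _ → rep A z ^ j))                        ≡⟨ ∑-cong E (λ z → cong (h z *_) (∑-elems-const q n (rep A z ^ j))) ⟩
      ∑ E (λ z → h z * (N * rep A z ^ j))                              ≡⟨ ∑-cong E (λ z → x∙yz≈y∙xz (h z) N (rep A z ^ j)) ⟩
      ∑ E (λ z → N * (h z * rep A z ^ j))                              ≡⟨ ∑-*ˡ E N _ ⟩
      N * ∑ E (λ z → h z * rep A z ^ j)                                ∎
      where open ≡-Reasoning

    module Averaging (A : Subset q n) (j : ℕ) (bad : G q n → Bool) where

      Q T : ℕ
      Q = moment E (rep A) j
      T = moment E (rep A) (suc j)

      B : Vec (G q n) j → Subset q n
      B = ⋂translates A

      unpopular-rep : Vec (G q n) j → ℕ
      unpopular-rep s = ∑ E (λ z → ⟦ bad z ⟧ * rep (B s) z)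

      energy : Vec (G q n) j → ℕ
      energy s = ∑ E (λ z → rep A z * rep (B s) z)

      record GoodTuple : Set where
        field
          s : Vec (G q n) j
          mostly-popular : 128 * unpopular-rep s ≤ card (B s) * card (B s)
          energy-bound : Q * energy s ≤ 2 * T * (card (B s) * card (B s))
          large : N * card A ^ j < 8 * N ^ j * card (B s)

      module _ (T>0 : 0 < T) (Q>0 : 0 < Q)
               (few-unpopular : 2 ^ 9 * ∑ E (λ z → ⟦ bad z ⟧ * rep A z ^ j) ≤ Q)
               (power-mean : N * (card A * card A) ^ j ≤ N ^ j * Q) where

        private
          X : ℕ
          X = T * N ^ j * N * Q

          -- Summed over all tuples the three costs are at most 4/16, 8/16 and 2/16 of the budget, and a
          -- tuple whose cost is below its budget satisfies each of the three conditions of GoodTuple.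
          budget cost₁ cost₂ cost₃ : Vec (G q n) j → ℕ
          budget s = 16 * T * N ^ j * (card (B s) * card (B s))
          cost₁ s = 2 ^ 11 * T * N ^ j * unpopular-rep s
          cost₂ s = 8 * N ^ j * Q * energy s
          cost₃ s = 2 * T * N * card A ^ j * card (B s)

          ∑-budget : ∑ (tuples j) budget ≡ 16 * X
          ∑-budget = begin
            ∑ (tuples j) budget                                            ≡⟨ ∑-*ˡ (tuples j) (16 * T * N ^ j) _ ⟩
            16 * T * N ^ j * ∑ (tuples j) (λ s → card (B s) * card (B s))  ≡⟨ cong (16 * T * N ^ j *_) ∑-card² ⟩
            16 * T * N ^ j * (N * Q)                                       ≡⟨ regroup T (N ^ j) N Q ⟩
            16 * X                                                         ∎
            where
            open ≡-Reasoning
            regroup : ∀ t p n q → 16 * t * p * (n * q) ≡ 16 * (t * p * n * q)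
            regroup = solve-∀
            ∑-card² : ∑ (tuples j) (λ s → card (B s) * card (B s)) ≡ N * Q
            ∑-card² = begin
              ∑ (tuples j) (λ s → card (B s) * card (B s))          ≡⟨ ∑-cong (tuples j) (λ s → trans (sym (∑-rep (B s))) (∑-cong E (λ z → sym (*-identityˡ _)))) ⟩
              ∑ (tuples j) (λ s → ∑ E (λ z → 1 * rep (B s) z))     ≡⟨ ∑-tuples-weighted-rep A j (λ _ → 1) ⟩
              N * ∑ E (λ z → 1 * rep A z ^ j)                       ≡⟨ cong (N *_) (∑-cong E (λ z → *-identityˡ _)) ⟩
              N * Q                                                 ∎

          ∑-cost₁ : ∑ (tuples j) cost₁ ≤ 4 * X
          ∑-cost₁ = begin
            ∑ (tuples j) cost₁                                             ≡⟨ ∑-*ˡ (tuples j) (2 ^ 11 * T * N ^ j) _ ⟩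
            2 ^ 11 * T * N ^ j * ∑ (tuples j) unpopular-rep                ≡⟨ cong (2 ^ 11 * T * N ^ j *_) (∑-tuples-weighted-rep A j (λ z → ⟦ bad z ⟧)) ⟩
            2 ^ 11 * T * N ^ j * (N * unpopular)                           ≡⟨ regroup T (N ^ j) N unpopular ⟩
            4 * (T * N ^ j * N) * (2 ^ 9 * unpopular)                      ≤⟨ *-monoʳ-≤ (4 * (T * N ^ j * N)) few-unpopular ⟩
            4 * (T * N ^ j * N) * Q                                        ≡⟨ *-assoc 4 (T * N ^ j * N) Q ⟩
            4 * X                                                          ∎
            where
            open ≤-Reasoning
            unpopular : ℕ
            unpopular = ∑ E (λ z → ⟦ bad z ⟧ * rep A z ^ j)
            regroup : ∀ t p n u → 2 ^ 11 * t * p * (n * u) ≡ 4 * (t * p * n) * (2 ^ 9 * u)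
            regroup = solve-∀

          ∑-cost₂ : ∑ (tuples j) cost₂ ≡ 8 * X
          ∑-cost₂ = begin
            ∑ (tuples j) cost₂                          ≡⟨ ∑-*ˡ (tuples j) (8 * N ^ j * Q) _ ⟩
            8 * N ^ j * Q * ∑ (tuples j) energy         ≡⟨ cong (8 * N ^ j * Q *_) (∑-tuples-weighted-rep A j (rep A)) ⟩
            8 * N ^ j * Q * (N * T)                     ≡⟨ regroup T (N ^ j) N Q ⟩
            8 * X                                       ∎
            where
            open ≡-Reasoning
            regroup : ∀ t p n q → 8 * p * q * (n * t) ≡ 8 * (t * p * n * q)
            regroup = solve-∀

          ∑-cost₃ : ∑ (tuples j) cost₃ ≤ 2 * X
          ∑-cost₃ = begin
            ∑ (tuples j) cost₃                                      ≡⟨ ∑-*ˡ (tuples j) (2 * T * N * card A ^ j) _ ⟩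
            2 * T * N * card A ^ j * ∑ (tuples j) (card ∘ B)        ≡⟨ cong (2 * T * N * card A ^ j *_) (∑-tuples-card A j) ⟩
            2 * T * N * card A ^ j * (N * card A ^ j)               ≡⟨ regroup T N (card A ^ j) ⟩
            2 * T * N * (N * (card A ^ j * card A ^ j))             ≡⟨ cong (λ x → 2 * T * N * (N * x)) (^-distribʳ-* (card A) (card A) j) ⟨
            2 * T * N * (N * (card A * card A) ^ j)                 ≤⟨ *-monoʳ-≤ (2 * T * N) power-mean ⟩
            2 * T * N * (N ^ j * Q)                                 ≡⟨ regroup′ T N (N ^ j) Q ⟩
            2 * X                                                   ∎
            where
            open ≤-Reasoning
            regroup : ∀ t n a → 2 * t * n * a * (n * a) ≡ 2 * t * n * (n * (a * a))
            regroup = solve-∀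
            regroup′ : ∀ t n p q → 2 * t * n * (p * q) ≡ 2 * (t * p * n * q)
            regroup′ = solve-∀

          cost : Vec (G q n) j → ℕ
          cost s = cost₁ s + cost₂ s + cost₃ s

          ∑-cost<∑-budget : ∑ (tuples j) cost < ∑ (tuples j) budget
          ∑-cost<∑-budget = begin-strict
            ∑ (tuples j) cost                                                  ≡⟨ ∑-distrib-+ (tuples j) _ cost₃ ⟩
            ∑ (tuples j) (λ s → cost₁ s + cost₂ s) + ∑ (tuples j) cost₃        ≡⟨ cong (_+ ∑ (tuples j) cost₃) (∑-distrib-+ (tuples j) cost₁ cost₂) ⟩
            ∑ (tuples j) cost₁ + ∑ (tuples j) cost₂ + ∑ (tuples j) cost₃       ≤⟨ +-mono-≤ (+-mono-≤ ∑-cost₁ (≤-reflexive ∑-cost₂)) ∑-cost₃ ⟩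
            4 * X + 8 * X + 2 * X                                              <⟨ 14x<16x X>0 ⟩
            16 * X                                                             ≡⟨ ∑-budget ⟨
            ∑ (tuples j) budget                                                ∎
            where
            open ≤-Reasoning
            X>0 : 0 < X
            X>0 = *-pos (*-pos (*-pos T>0 (^-pos j N>0)) N>0) Q>0
            14x<16x : ∀ {x} → 0 < x → 4 * x + 8 * x + 2 * x < 16 * x
            14x<16x {x} x>0 = subst₂ _<_ (sum-14 x) (sum-16 x) (+-monoʳ-< (14 * x) (*-pos {2} z<s x>0))
              where
              sum-14 : ∀ x → 14 * x + 0 ≡ 4 * x + 8 * x + 2 * x
              sum-14 = solve-∀
              sum-16 : ∀ x → 14 * x + 2 * x ≡ 16 * x
              sum-16 = solve-∀

        good-tuple : GoodTuple
        good-tuple = cheap-tuple (∑<∑⇒∃< (tuples j) cost budget ∑-cost<∑-budget)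
          where
          cheap-tuple : ∃[ s ] cost s < budget s → GoodTuple
          cheap-tuple (s , cost<budget) = record
            { s = s
            ; mostly-popular = *-cancelʳ-≤-pos (16 * (T * N ^ j)) (*-pos {16} z<s (*-pos T>0 (^-pos j N>0))) (begin
                128 * unpopular-rep s * (16 * (T * N ^ j))   ≡⟨ regroup₁ T (N ^ j) (unpopular-rep s) ⟩
                cost₁ s                                     ≤⟨ ≤-trans (m≤m+n (cost₁ s) (cost₂ s)) (m≤m+n _ (cost₃ s)) ⟩
                cost s                                      ≤⟨ <⇒≤ cost<budget ⟩
                budget s                                    ≡⟨ regroup₂ T (N ^ j) (b * b) ⟩
                b * b * (16 * (T * N ^ j))                  ∎)
            ; energy-bound = *-cancelʳ-≤-pos (8 * N ^ j) (*-pos {8} z<s (^-pos j N>0)) (begin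
                Q * energy s * (8 * N ^ j)                  ≡⟨ regroup₃ (N ^ j) Q (energy s) ⟩
                cost₂ s                                     ≤⟨ ≤-trans (m≤n+m (cost₂ s) (cost₁ s)) (m≤m+n _ (cost₃ s)) ⟩
                cost s                                      ≤⟨ <⇒≤ cost<budget ⟩
                budget s                                    ≡⟨ regroup₄ T (N ^ j) (b * b) ⟩
                2 * T * (b * b) * (8 * N ^ j)               ∎)
            ; large = *-cancelʳ-< (2 * T * b) (N * card A ^ j) (8 * N ^ j * b) (begin-strict
                N * card A ^ j * (2 * T * b)                ≡⟨ regroup₅ T N (card A ^ j) b ⟩
                cost₃ s                                     ≤⟨ m≤n+m (cost₃ s) _ ⟩
                cost s                                      <⟨ cost<budget ⟩
                budget s                                    ≡⟨ regroup₆ T (N ^ j) b ⟩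
                8 * N ^ j * b * (2 * T * b)                 ∎)
            }
            where
            open ≤-Reasoning
            b : ℕ
            b = card (B s)
            regroup₁ : ∀ t p u → 128 * u * (16 * (t * p)) ≡ 2 ^ 11 * t * p * u
            regroup₁ = solve-∀
            regroup₂ : ∀ t p c → 16 * t * p * c ≡ c * (16 * (t * p))
            regroup₂ = solve-∀
            regroup₃ : ∀ p q w → q * w * (8 * p) ≡ 8 * p * q * w
            regroup₃ = solve-∀
            regroup₄ : ∀ t p c → 16 * t * p * c ≡ 2 * t * c * (8 * p)
            regroup₄ = solve-∀
            regroup₅ : ∀ t n a b → n * a * (2 * t * b) ≡ 2 * t * n * a * b
            regroup₅ = solve-∀
            regroup₆ : ∀ t p b → 16 * t * p * (b * b) ≡ 8 * p * b * (2 * t * b)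
            regroup₆ = solve-∀

module Fractions where

  open import Defs
  open ListSum
  open NatLemmas
  open GroupSums using (size>0)
  open Representations using (rep)
  open import Data.Bool using (true; false)
  open import Data.Integer as ℤ using (+_)
  import Data.Integer.Properties as ℤ
  open import Data.List using (List; []; _∷_; map)
  open import Data.Nat as ℕ using (ℕ; suc; z<s)
  import Data.Nat.Properties as ℕ
  open import Data.Nat.Tactic.RingSolver using (solve-∀)
  open import Data.Rational as ℚ using (ℚ; toℚᵘ)
  import Data.Rational.Properties as ℚ
  open import Data.Rational.Unnormalised as ℚᵘ using (mkℚᵘ; *≤*)
  import Data.Rational.Unnormalised.Properties as ℚᵘ
  open import Relation.Binary.PropositionalEquality

  private
    toℚᵘ-frac : ∀ a b → toℚᵘ (frac a (suc b)) ℚᵘ.≃ mkℚᵘ (+ a) b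
    toℚᵘ-frac a b = ℚ.toℚᵘ-fromℚᵘ (mkℚᵘ (+ a) b)

    +-* : ∀ a b → + a ℤ.* + b ≡ + (a ℕ.* b)
    +-* a b = sym (ℤ.pos-* a b)

  frac-≤ : ∀ {a b c d} → 0 ℕ.< b → 0 ℕ.< d → a ℕ.* d ℕ.≤ c ℕ.* b → frac a b ℚ.≤ frac c d
  frac-≤ {a} {suc b} {c} {suc d} _ _ ad≤cb =
    ℚ.toℚᵘ-cancel-≤ (ℚᵘ.≤-respʳ-≃ (ℚᵘ.≃-sym (toℚᵘ-frac c d)) (ℚᵘ.≤-respˡ-≃ (ℚᵘ.≃-sym (toℚᵘ-frac a b))
      (*≤* (subst₂ ℤ._≤_ (sym (+-* a (suc d))) (sym (+-* c (suc b))) (ℤ.+≤+ ad≤cb)))))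

  frac-≤⁻ : ∀ {a b c d} → 0 ℕ.< b → 0 ℕ.< d → frac a b ℚ.≤ frac c d → a ℕ.* d ℕ.≤ c ℕ.* b
  frac-≤⁻ {a} {suc b} {c} {suc d} _ _ a/b≤c/d
    with ℚᵘ.≤-respʳ-≃ (toℚᵘ-frac c d) (ℚᵘ.≤-respˡ-≃ (toℚᵘ-frac a b) (ℚ.toℚᵘ-mono-≤ a/b≤c/d))
  ... | *≤* ad≤cb = ℤ.drop‿+≤+ (subst₂ ℤ._≤_ (+-* a (suc d)) (+-* c (suc b)) ad≤cb)

  frac-cong : ∀ {a b c d} → 0 ℕ.< b → 0 ℕ.< d → a ℕ.* d ≡ c ℕ.* b → frac a b ≡ frac c d
  frac-cong b>0 d>0 ad≡cb = ℚ.≤-antisym (frac-≤ b>0 d>0 (ℕ.≤-reflexive ad≡cb)) (frac-≤ d>0 b>0 (ℕ.≤-reflexive (sym ad≡cb)))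

  frac-* : ∀ {a b c d} → 0 ℕ.< b → 0 ℕ.< d → frac a b ℚ.* frac c d ≡ frac (a ℕ.* c) (b ℕ.* d)
  frac-* {a} {suc b} {c} {suc d} _ _ = ℚ.toℚᵘ-injective (begin
    toℚᵘ (frac a (suc b) ℚ.* frac c (suc d))           ≈⟨ ℚ.toℚᵘ-homo-* (frac a (suc b)) (frac c (suc d)) ⟩
    toℚᵘ (frac a (suc b)) ℚᵘ.* toℚᵘ (frac c (suc d))   ≈⟨ ℚᵘ.*-cong (toℚᵘ-frac a b) (toℚᵘ-frac c d) ⟩
    mkℚᵘ (+ a ℤ.* + c) (d ℕ.+ b ℕ.* suc d)             ≡⟨ cong (λ n → mkℚᵘ n (d ℕ.+ b ℕ.* suc d)) (+-* a c) ⟩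
    mkℚᵘ (+ (a ℕ.* c)) (d ℕ.+ b ℕ.* suc d)             ≈⟨ toℚᵘ-frac (a ℕ.* c) (d ℕ.+ b ℕ.* suc d) ⟨
    toℚᵘ (frac (a ℕ.* c) (suc b ℕ.* suc d))            ∎)
    where open ℚᵘ.≃-Reasoning

  frac-+ : ∀ {a b c d} → 0 ℕ.< b → 0 ℕ.< d → frac a b ℚ.+ frac c d ≡ frac (a ℕ.* d ℕ.+ c ℕ.* b) (b ℕ.* d)
  frac-+ {a} {suc b} {c} {suc d} _ _ = ℚ.toℚᵘ-injective (begin
    toℚᵘ (frac a (suc b) ℚ.+ frac c (suc d))           ≈⟨ ℚ.toℚᵘ-homo-+ (frac a (suc b)) (frac c (suc d)) ⟩
    toℚᵘ (frac a (suc b)) ℚᵘ.+ toℚᵘ (frac c (suc d))   ≈⟨ ℚᵘ.+-cong (toℚᵘ-frac a b) (toℚᵘ-frac c d) ⟩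
    mkℚᵘ (+ a ℤ.* + suc d ℤ.+ + c ℤ.* + suc b) (d ℕ.+ b ℕ.* suc d)
      ≡⟨ cong (λ n → mkℚᵘ n (d ℕ.+ b ℕ.* suc d)) numerator ⟩
    mkℚᵘ (+ (a ℕ.* suc d ℕ.+ c ℕ.* suc b)) (d ℕ.+ b ℕ.* suc d)
      ≈⟨ toℚᵘ-frac (a ℕ.* suc d ℕ.+ c ℕ.* suc b) (d ℕ.+ b ℕ.* suc d) ⟨
    toℚᵘ (frac (a ℕ.* suc d ℕ.+ c ℕ.* suc b) (suc b ℕ.* suc d)) ∎)
    where
    open ℚᵘ.≃-Reasoning
    numerator : + a ℤ.* + suc d ℤ.+ + c ℤ.* + suc b ≡ + (a ℕ.* suc d ℕ.+ c ℕ.* suc b)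
    numerator = trans (cong₂ ℤ._+_ (+-* a (suc d)) (+-* c (suc b))) (sym (ℤ.pos-+ (a ℕ.* suc d) (c ℕ.* suc b)))

  frac-^ : ∀ {a b} e → 0 ℕ.< b → frac a b ^ e ≡ frac (a ℕ.^ e) (b ℕ.^ e)
  frac-^ ℕ.zero _ = refl
  frac-^ {a} {b} (suc e) b>0 = trans (cong (frac a b ℚ.*_) (frac-^ e b>0)) (frac-* b>0 (^-pos e b>0))

  sumQ-frac : ∀ {X : Set} (xs : List X) {f : X → ℚ} {g : X → ℕ} {d} → 0 ℕ.< d →
              (∀ x → f x ≡ frac (g x) d) → sumQ (map f xs) ≡ frac (∑ xs g) d
  sumQ-frac [] {d = d} d>0 f≡g/d = frac-cong {0} {1} {0} {d} z<s d>0 refl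
  sumQ-frac (x ∷ xs) {f} {g} {d} d>0 f≡g/d = begin
    f x ℚ.+ sumQ (map f xs)                             ≡⟨ cong₂ ℚ._+_ (f≡g/d x) (sumQ-frac xs d>0 f≡g/d) ⟩
    frac (g x) d ℚ.+ frac (∑ xs g) d                     ≡⟨ frac-+ d>0 d>0 ⟩
    frac (g x ℕ.* d ℕ.+ ∑ xs g ℕ.* d) (d ℕ.* d)          ≡⟨ frac-cong (*-pos d>0 d>0) d>0 (common-denominator (g x) (∑ xs g) d) ⟩
    frac (g x ℕ.+ ∑ xs g) d                              ∎
    where
    open ≡-Reasoning
    common-denominator : ∀ a b d → (a ℕ.* d ℕ.+ b ℕ.* d) ℕ.* d ≡ (a ℕ.+ b) ℕ.* (d ℕ.* d)
    common-denominator = solve-∀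

  module _ {k n : ℕ} where

    private
      N : ℕ
      N = size (suc k) n

    𝔼-frac : ∀ {f : G (suc k) n → ℚ} {g : G (suc k) n → ℕ} {d} → 0 ℕ.< d →
             (∀ x → f x ≡ frac (g x) d) → 𝔼 f ≡ frac (∑ (elems (suc k) n) g) (N ℕ.* d)
    𝔼-frac {f} {g} {d} d>0 f≡g/d = begin
      frac 1 N ℚ.* sumQ (map f (elems (suc k) n))        ≡⟨ cong (frac 1 N ℚ.*_) (sumQ-frac (elems (suc k) n) d>0 f≡g/d) ⟩
      frac 1 N ℚ.* frac (∑ (elems (suc k) n) g) d        ≡⟨ frac-* (size>0 {k} {n}) d>0 ⟩
      frac (1 ℕ.* ∑ (elems (suc k) n) g) (N ℕ.* d)       ≡⟨ cong (λ a → frac a (N ℕ.* d)) (ℕ.*-identityˡ _) ⟩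
      frac (∑ (elems (suc k) n) g) (N ℕ.* d)             ∎
      where open ≡-Reasoning

    𝟙-frac : ∀ (X : Subset (suc k) n) x → 𝟙 X x ≡ frac ⟦ X x ⟧ 1
    𝟙-frac X x with X x
    ... | true = refl
    ... | false = refl

    μ-frac : ∀ (X : Subset (suc k) n) → 0 ℕ.< card X → ∀ x → μ X x ≡ frac (⟦ X x ⟧ ℕ.* N) (card X)
    μ-frac X X≢∅ x with X x
    ... | true = cong (λ a → frac a (card X)) (sym (ℕ.*-identityˡ N))
    ... | false = frac-cong {0} {1} {0} {card X} z<s X≢∅ refl

    μ⊚μ-frac : ∀ (X : Subset (suc k) n) → 0 ℕ.< card X → ∀ z → (μ X ⊚ μ X) z ≡ frac (rep X z ℕ.* N) (card X ℕ.* card X)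
    μ⊚μ-frac X X≢∅ z = begin
      𝔼 (λ y → μ X y ℚ.* μ X (z ⊕ y))                                    ≡⟨ 𝔼-frac (*-pos X≢∅ X≢∅) pointwise ⟩
      frac (∑ (elems (suc k) n) (λ y → ⟦ X y ⟧ ℕ.* ⟦ X (z ⊕ y) ⟧ ℕ.* (N ℕ.* N))) (N ℕ.* c²)
        ≡⟨ cong (λ a → frac a (N ℕ.* c²)) (∑-*ʳ (elems (suc k) n) (N ℕ.* N) _) ⟩
      frac (rep X z ℕ.* (N ℕ.* N)) (N ℕ.* c²)                            ≡⟨ frac-cong (*-pos (size>0 {k} {n}) c²>0) c²>0 (cancel-N (rep X z) N c²) ⟩
      frac (rep X z ℕ.* N) c²                                            ∎
      where
      open ≡-Reasoning
      c² : ℕ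
      c² = card X ℕ.* card X
      c²>0 : 0 ℕ.< c²
      c²>0 = *-pos X≢∅ X≢∅
      cancel-N : ∀ r N c → r ℕ.* (N ℕ.* N) ℕ.* c ≡ r ℕ.* N ℕ.* (N ℕ.* c)
      cancel-N = solve-∀
      regroup : ∀ a b N → a ℕ.* N ℕ.* (b ℕ.* N) ≡ a ℕ.* b ℕ.* (N ℕ.* N)
      regroup = solve-∀
      pointwise : ∀ y → μ X y ℚ.* μ X (z ⊕ y) ≡ frac (⟦ X y ⟧ ℕ.* ⟦ X (z ⊕ y) ⟧ ℕ.* (N ℕ.* N)) c²
      pointwise y = begin
        μ X y ℚ.* μ X (z ⊕ y)                                          ≡⟨ cong₂ ℚ._*_ (μ-frac X X≢∅ y) (μ-frac X X≢∅ (z ⊕ y)) ⟩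
        frac (⟦ X y ⟧ ℕ.* N) (card X) ℚ.* frac (⟦ X (z ⊕ y) ⟧ ℕ.* N) (card X) ≡⟨ frac-* X≢∅ X≢∅ ⟩
        frac (⟦ X y ⟧ ℕ.* N ℕ.* (⟦ X (z ⊕ y) ⟧ ℕ.* N)) c²              ≡⟨ cong (λ a → frac a c²) (regroup ⟦ X y ⟧ ⟦ X (z ⊕ y) ⟧ N) ⟩
        frac (⟦ X y ⟧ ℕ.* ⟦ X (z ⊕ y) ⟧ ℕ.* (N ℕ.* N)) c²              ∎

module CeilLog where

  open import Defs using (Subset; card; size; Lceil)
  open import Data.Nat using (suc; z≤n; s≤s; s≤s⁻¹; _+_; _*_; _^_; _≤_; _<_; _/_; _%_; ⌈_/2⌉; ⌊_/2⌋)
  open import Data.Nat.DivMod using (m≡m%n+[m/n]*n; m%n<n)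
  open import Data.Nat.Logarithm using (⌈log₂_⌉)
  open import Data.Nat.Logarithm.Core using (⌈log2⌉)
  open import Data.Nat.Properties
  open import Data.Nat.Tactic.RingSolver using (solve-∀)
  open import Induction.WellFounded using (Acc; acc)
  open import Relation.Binary.PropositionalEquality
  open ≤-Reasoning

  private
    ≤2^⌈log2⌉ : ∀ x (acc : Acc _<_ x) → x ≤ 2 ^ ⌈log2⌉ x acc
    ≤2^⌈log2⌉ 0 _ = z≤n
    ≤2^⌈log2⌉ 1 _ = s≤s z≤n
    ≤2^⌈log2⌉ (suc (suc x)) (acc rs) = begin
      2 + x                      ≤⟨ +-monoʳ-≤ 2 (≤-trans (≤-reflexive (sym (⌊n/2⌋+⌈n/2⌉≡n x))) (+-monoˡ-≤ ⌈ x /2⌉ (⌊n/2⌋≤⌈n/2⌉ x))) ⟩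
      2 + (⌈ x /2⌉ + ⌈ x /2⌉)    ≡⟨ double ⌈ x /2⌉ ⟩
      2 * suc ⌈ x /2⌉            ≤⟨ *-monoʳ-≤ 2 (≤2^⌈log2⌉ (suc ⌈ x /2⌉) (rs (⌈n/2⌉<n x))) ⟩
      2 * 2 ^ ⌈log2⌉ (suc ⌈ x /2⌉) (rs (⌈n/2⌉<n x))   ∎
      where
      double : ∀ c → 2 + (c + c) ≡ 2 * suc c
      double = solve-∀

  ≤2^⌈log₂⌉ : ∀ x → x ≤ 2 ^ ⌈log₂ x ⌉
  ≤2^⌈log₂⌉ x = ≤2^⌈log2⌉ x _

  ≤[m+n]/[1+n]*[1+n] : ∀ m n → m ≤ (m + n) / suc n * suc n
  ≤[m+n]/[1+n]*[1+n] m n = +-cancelʳ-≤ n m _ (begin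
    m + n                                            ≡⟨ m≡m%n+[m/n]*n (m + n) (suc n) ⟩
    (m + n) % suc n + (m + n) / suc n * suc n        ≤⟨ +-monoˡ-≤ _ (s≤s⁻¹ (m%n<n (m + n) (suc n))) ⟩
    n + (m + n) / suc n * suc n                      ≡⟨ +-comm n _ ⟩
    (m + n) / suc n * suc n + n                      ∎)

  2*size≤2^Lceil*card : ∀ {q n} (A : Subset q n) → 0 < card A → 2 * size q n ≤ 2 ^ Lceil A * card A
  2*size≤2^Lceil*card {q} {n} A A≢∅ with card A
  ... | suc a = begin
    2 * size q n                                         ≤⟨ ≤[m+n]/[1+n]*[1+n] (2 * size q n) a ⟩
    (2 * size q n + a) / suc a * suc a                   ≤⟨ *-monoˡ-≤ (suc a) (≤2^⌈log₂⌉ ((2 * size q n + a) / suc a)) ⟩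
    2 ^ ⌈log₂ ((2 * size q n + a) / suc a) ⌉ * suc a     ∎

module Construction where

  open import Defs hiding (_^_)
  open import Defs using () renaming (_^_ to _^ℚ_)
  open ListSum
  open GroupSums using (∑-elems-const; size>0)
  open NatLemmas
  open Moments
  open Representations
  open Fractions
  open CeilLog using (2*size≤2^Lceil*card)
  open import Data.Bool using (Bool; true; false; not; T)
  open import Data.Empty using (⊥)
  open import Data.Nat as ℕ using (ℕ; suc; z<s; _+_; _*_; _^_; _∸_; _≤_; _<_; >-nonZero)
  open import Data.Nat.Properties
  open import Algebra.Properties.CommutativeSemigroup *-commutativeSemigroup using (x∙yz≈y∙xz)
  open import Relation.Nullary using (contradiction)
  open import Data.Nat.Tactic.RingSolver using (solve-∀)
  open import Data.List using (List)
  open import Data.Product using (∃-syntax; _×_; _,_; proj₁; proj₂)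
  open import Data.Rational as ℚ using (ℚ; 1ℚ)
  open import Data.Vec using (Vec)
  import Data.Rational.Properties as ℚ
  open import Relation.Binary.PropositionalEquality

  2^L*256^[256L]≤257^[256L] : ∀ L → 2 ^ L * 256 ^ (256 * L) ≤ 257 ^ (256 * L)
  2^L*256^[256L]≤257^[256L] L = begin
    2 ^ L * 256 ^ (256 * L)       ≡⟨ cong (2 ^ L *_) (^-*-assoc 256 256 L) ⟨
    2 ^ L * (256 ^ 256) ^ L       ≡⟨ ^-distribʳ-* 2 (256 ^ 256) L ⟨
    (2 * 256 ^ 256) ^ L           ≤⟨ ^-monoˡ-≤ L (≤ᵇ⇒≤ (2 * 256 ^ 256) (257 ^ 256) _) ⟩
    (257 ^ 256) ^ L               ≡⟨ ^-*-assoc 257 256 L ⟩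
    257 ^ (256 * L)               ∎
    where open ≤-Reasoning

  growth-overshoots : ∀ {N a L} → 0 < a → 2 * N ≤ 2 ^ L * a → 8 * N * a * 256 ^ (256 * L) < 9 * (a * a) * 257 ^ (256 * L)
  growth-overshoots {N} {a} {L} a>0 2N≤2^La = *-cancelˡ-< 2 _ _ (begin-strict
    2 * (8 * N * a * 256 ^ W)          ≡⟨ regroup₁ N a (256 ^ W) ⟩
    8 * a * 256 ^ W * (2 * N)          ≤⟨ *-monoʳ-≤ (8 * a * 256 ^ W) 2N≤2^La ⟩
    8 * a * 256 ^ W * (2 ^ L * a)      ≡⟨ regroup₂ a (256 ^ W) (2 ^ L) ⟩
    8 * (a * a) * (2 ^ L * 256 ^ W)    ≤⟨ *-monoʳ-≤ (8 * (a * a)) (2^L*256^[256L]≤257^[256L] L) ⟩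
    8 * (a * a) * 257 ^ W              <⟨ *-monoˡ-< (257 ^ W) {{m^n≢0 257 W}} (*-monoˡ-< (a * a) {{>-nonZero (*-pos a>0 a>0)}} (≤ᵇ⇒≤ 9 18 _)) ⟩
    18 * (a * a) * 257 ^ W             ≡⟨ regroup₃ (a * a) (257 ^ W) ⟩
    2 * (9 * (a * a) * 257 ^ W)        ∎)
    where
    open ≤-Reasoning
    W : ℕ
    W = 256 * L
    regroup₁ : ∀ N a P → 2 * (8 * N * a * P) ≡ 8 * a * P * (2 * N)
    regroup₁ = solve-∀
    regroup₂ : ∀ a P Q → 8 * a * P * (Q * a) ≡ 8 * (a * a) * (Q * P)
    regroup₂ = solve-∀
    regroup₃ : ∀ x P → 18 * x * P ≡ 2 * (9 * x * P)
    regroup₃ = solve-∀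

  8*a^20≤N^20 : ∀ {a N} → 9 * a ≤ 8 * N → 8 * a ^ 20 ≤ N ^ 20
  8*a^20≤N^20 {a} {N} 9a≤8N = *-cancelˡ-≤ (9 ^ 20) {{m^n≢0 9 20}} (begin
    9 ^ 20 * (8 * a ^ 20)       ≡⟨ x∙yz≈y∙xz (9 ^ 20) 8 (a ^ 20) ⟩
    8 * (9 ^ 20 * a ^ 20)       ≡⟨ cong (8 *_) (^-distribʳ-* 9 a 20) ⟨
    8 * (9 * a) ^ 20            ≤⟨ *-monoʳ-≤ 8 (^-monoˡ-≤ 20 9a≤8N) ⟩
    8 * (8 * N) ^ 20            ≡⟨ cong (8 *_) (^-distribʳ-* 8 N 20) ⟩
    8 * (8 ^ 20 * N ^ 20)       ≡⟨ *-assoc 8 (8 ^ 20) (N ^ 20) ⟨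
    8 * 8 ^ 20 * N ^ 20         ≤⟨ *-monoˡ-≤ (N ^ 20) (≤ᵇ⇒≤ (8 * 8 ^ 20) (9 ^ 20) _) ⟩
    9 ^ 20 * N ^ 20             ∎)
    where open ≤-Reasoning

  density-amplification : ∀ {a N b j e} → 9 * a ≤ 8 * N → N * a ^ j < 8 * N ^ j * b → j + 20 ≤ e → a ^ e * N ≤ b * N ^ e
  density-amplification {a} {N} {b} {j} {e} 9a≤8N large j+20≤e =
    subst (λ e → a ^ e * N ≤ b * N ^ e) (m+[n∸m]≡n j+20≤e) (begin
      a ^ (j + 20 + r) * N               ≡⟨ cong (_* N) (^-split a) ⟩
      a ^ r * a ^ 20 * a ^ j * N         ≡⟨ *-assoc (a ^ r * a ^ 20) (a ^ j) N ⟩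
      a ^ r * a ^ 20 * (a ^ j * N)       ≡⟨ cong (a ^ r * a ^ 20 *_) (*-comm (a ^ j) N) ⟩
      a ^ r * a ^ 20 * (N * a ^ j)       ≤⟨ *-monoʳ-≤ (a ^ r * a ^ 20) (<⇒≤ large) ⟩
      a ^ r * a ^ 20 * (8 * N ^ j * b)   ≡⟨ regroup (a ^ r) (a ^ 20) (N ^ j) b ⟩
      a ^ r * (8 * a ^ 20) * (N ^ j * b) ≤⟨ *-monoˡ-≤ (N ^ j * b) (*-mono-≤ (^-monoˡ-≤ r a≤N) (8*a^20≤N^20 {a} {N} 9a≤8N)) ⟩
      N ^ r * N ^ 20 * (N ^ j * b)       ≡⟨ regroup′ (N ^ r * N ^ 20) (N ^ j) b ⟩
      b * (N ^ r * N ^ 20 * N ^ j)       ≡⟨ cong (b *_) (^-split N) ⟨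
      b * N ^ (j + 20 + r)               ∎)
    where
    open ≤-Reasoning
    r : ℕ
    r = e ∸ (j + 20)
    a≤N : a ≤ N
    a≤N = *-cancelˡ-≤ 9 (≤-trans 9a≤8N (*-monoˡ-≤ N (n≤1+n 8)))
    ^-split : ∀ x → x ^ (j + 20 + r) ≡ x ^ r * x ^ 20 * x ^ j
    ^-split x = begin-equality
      x ^ (j + 20 + r)            ≡⟨ ^-distribˡ-+-* x (j + 20) r ⟩
      x ^ (j + 20) * x ^ r        ≡⟨ cong (_* x ^ r) (^-distribˡ-+-* x j 20) ⟩
      x ^ j * x ^ 20 * x ^ r      ≡⟨ reverse (x ^ j) (x ^ 20) (x ^ r) ⟩
      x ^ r * x ^ 20 * x ^ j      ∎
      where
      reverse : ∀ u v w → u * v * w ≡ w * v * u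
      reverse = solve-∀
    regroup : ∀ u v P b → u * v * (8 * P * b) ≡ u * (8 * v) * (P * b)
    regroup = solve-∀
    regroup′ : ∀ u P b → u * (P * b) ≡ b * (u * P)
    regroup′ = solve-∀

  2^9*[127*257]^2048≤[128*256]^2048 : 2 ^ 9 * (127 * 257) ^ 2048 ≤ (128 * 256) ^ 2048
  2^9*[127*257]^2048≤[128*256]^2048 = ≤ᵇ⇒≤ _ _ _

  module Structure {k n : ℕ} (p′ : ℕ) (A : Subset (suc k) n) (A≢∅ : 0 < card A)
           (hyp : (1ℚ ℚ.+ frac 1 8) ^ℚ suc p′ ℚ.≤ powMean (μ A ⊚ μ A) (suc p′))
           (m : ℕ) (m-decay : 2 ^ 9 * (127 * 257) ^ m ≤ (128 * 256) ^ m) where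

    private
      p N a : ℕ
      p = suc p′
      N = size (suc k) n
      a = card A
      E : List (G (suc k) n)
      E = elems (suc k) n
      a²>0 : 0 < a * a
      a²>0 = *-pos A≢∅ A≢∅
      N>0 : 0 < N
      N>0 = size>0 {k} {n}

    M : ℕ → ℕ
    M = moment E (rep A)

    M-pos : ∀ j → 0 < M j
    M-pos = moment-pos (rep A) E (subst (0 <_) (sym (∑-rep A)) a²>0)

    M0≡N : M 0 ≡ N
    M0≡N = trans (∑-elems-const (suc k) n 1) (*-identityʳ N)

    M1≡a² : M 1 ≡ a * a
    M1≡a² = trans (∑-cong E (λ z → *-identityʳ (rep A z))) (∑-rep A)

    M-suc-≤ : ∀ j → M (suc j) ≤ a * M j
    M-suc-≤ = moment-suc-≤ (rep A) E (rep≤card A)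

    open LogConvexSequence M M-pos (moment-logConvex (rep A) E)

    powMean≡ : powMean (μ A ⊚ μ A) p ≡ frac (M p * N ^ p) (N * (a * a) ^ p)
    powMean≡ = trans (𝔼-frac (^-pos p a²>0) pointwise) (cong (λ x → frac x (N * (a * a) ^ p)) (∑-*ʳ E (N ^ p) (λ z → rep A z ^ p)))
      where
      open ≡-Reasoning
      pointwise : ∀ z → (μ A ⊚ μ A) z ^ℚ p ≡ frac (rep A z ^ p * N ^ p) ((a * a) ^ p)
      pointwise z = begin
        (μ A ⊚ μ A) z ^ℚ p                      ≡⟨ cong (_^ℚ p) (μ⊚μ-frac A A≢∅ z) ⟩
        frac (rep A z * N) (a * a) ^ℚ p          ≡⟨ frac-^ p a²>0 ⟩
        frac ((rep A z * N) ^ p) ((a * a) ^ p)   ≡⟨ cong (λ x → frac x ((a * a) ^ p)) (^-distribʳ-* (rep A z) N p) ⟩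
        frac (rep A z ^ p * N ^ p) ((a * a) ^ p) ∎

    power-mean-large : 9 ^ p * M 0 * M 1 ^ p ≤ 8 ^ p * M 0 ^ p * M p
    power-mean-large = begin
      9 ^ p * M 0 * M 1 ^ p        ≡⟨ cong₂ (λ x y → 9 ^ p * x * y ^ p) M0≡N M1≡a² ⟩
      9 ^ p * N * (a * a) ^ p      ≡⟨ *-assoc (9 ^ p) N _ ⟩
      9 ^ p * (N * (a * a) ^ p)    ≤⟨ frac-≤⁻ {9 ^ p} {8 ^ p} {M p * N ^ p} (^-pos p z<s) (*-pos N>0 (^-pos p a²>0)) (subst₂ ℚ._≤_ (frac-^ {9} {8} p z<s) powMean≡ hyp) ⟩
      M p * N ^ p * 8 ^ p          ≡⟨ reverse (M p) (N ^ p) (8 ^ p) ⟩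
      8 ^ p * N ^ p * M p          ≡⟨ cong (λ x → 8 ^ p * x ^ p * M p) M0≡N ⟨
      8 ^ p * M 0 ^ p * M p        ∎
      where
      open ≤-Reasoning
      reverse : ∀ x y z → x * y * z ≡ z * y * x
      reverse = solve-∀

    ratio-at-p : 9 * M 1 * M p′ ≤ 8 * M 0 * M p
    ratio-at-p = ratio-from-power-mean 9 8 p′ power-mean-large

    private
      slow : ∃[ i ] i < 256 * Lceil A × SlowWindow 256 257 m (i * m + p′)
      slow = slow-window-exists {256} {257} {9 * M 1} {8 * M 0} m p′ (256 * Lceil A) M-suc-≤ ratio-at-p
               (subst₂ (λ x y → 8 * x * a * 256 ^ (256 * Lceil A) < 9 * y * 257 ^ (256 * Lceil A)) (sym M0≡N) (sym M1≡a²)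
                       (growth-overshoots {N} {a} {Lceil A} A≢∅ (2*size≤2^Lceil*card A A≢∅)))

    j₀ j : ℕ
    j₀ = proj₁ slow * m + p′
    j = j₀ + m

    j₀-slow : SlowWindow 256 257 m j₀
    j₀-slow = proj₂ (proj₂ slow)

    j≤ : j ≤ 256 * Lceil A * m + p′ + m
    j≤ = +-monoˡ-≤ m (+-monoˡ-≤ p′ (*-monoˡ-≤ m (<⇒≤ (proj₁ (proj₂ slow)))))

    -- Stated with suc p′ rather than p: the theorem's exponent must match syntactically, since
    -- comparing 2097152 * x with 2097152 * y by unfolding the multiplication is infeasible.
    j+20≤ : m ≤ 2048 → j + 20 ≤ 2097152 * (suc p′ + Lceil A)
    j+20≤ m≤2048 = begin
      j + 20
        ≤⟨ +-monoˡ-≤ 20 j≤ ⟩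
      256 * Lceil A * m + p′ + m + 20
        ≤⟨ +-monoˡ-≤ 20 (+-mono-≤ (+-monoˡ-≤ p′ (*-monoʳ-≤ (256 * Lceil A) m≤2048)) m≤2048) ⟩
      256 * Lceil A * 2048 + p′ + 2048 + 20
        ≡⟨ regroup (Lceil A) p′ ⟩
      256 * 2048 * Lceil A + p′ + 2068
        ≤⟨ +-mono-≤ (+-mono-≤ (*-monoˡ-≤ (Lceil A) (≤ᵇ⇒≤ (256 * 2048) 2097152 _)) (m≤n*m p′ 2097152)) (≤ᵇ⇒≤ 2068 2097152 _) ⟩
      2097152 * Lceil A + 2097152 * p′ + 2097152
        ≡⟨ distribute 2097152 p′ (Lceil A) ⟨
      2097152 * (suc p′ + Lceil A)
        ∎
      where
      open ≤-Reasoning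
      regroup : ∀ L p → 256 * L * 2048 + p + 2048 + 20 ≡ 256 * 2048 * L + p + 2068
      regroup = solve-∀
      distribute : ∀ c p L → c * (suc p + L) ≡ c * L + c * p + c
      distribute = solve-∀

    Mⱼ Mⱼ₊₁ : ℕ
    Mⱼ = M j
    Mⱼ₊₁ = M (suc j)

    ratio-at-j : 9 * (a * a) * Mⱼ ≤ 8 * N * Mⱼ₊₁
    ratio-at-j = subst₂ (λ x y → 9 * y * Mⱼ ≤ 8 * x * Mⱼ₊₁) M0≡N M1≡a² (ratio-mono {9 * M 1} {8 * M 0} (≤-trans (m≤n+m p′ (proj₁ slow * m)) (m≤m+n j₀ m)) ratio-at-p)

    power-mean-at-j : N * (a * a) ^ j ≤ N ^ j * Mⱼ
    power-mean-at-j = subst₂ (λ x y → x * y ^ j ≤ x ^ j * Mⱼ) M0≡N M1≡a² (power-mean j)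

    9a≤8N : 9 * a ≤ 8 * N
    9a≤8N = *-cancelʳ-≤-pos (a * Mⱼ) (*-pos A≢∅ (M-pos j)) (begin
      9 * a * (a * Mⱼ)      ≡⟨ regroup a Mⱼ ⟩
      9 * (a * a) * Mⱼ      ≤⟨ ratio-at-j ⟩
      8 * N * Mⱼ₊₁          ≤⟨ *-monoʳ-≤ (8 * N) (M-suc-≤ j) ⟩
      8 * N * (a * Mⱼ)      ∎)
      where
      open ≤-Reasoning
      regroup : ∀ a x → 9 * a * (a * x) ≡ 9 * (a * a) * x
      regroup = solve-∀

    -- σ = 𝔼 f^{j+1} / 𝔼 f^j for f = μ_A ∘ μ_A
    σ : ℚ
    σ = frac (N * Mⱼ₊₁) (a * a * Mⱼ)

    popular : G (suc k) n → Bool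
    popular x = ((1ℚ ℚ.- frac 1 128) ℚ.* σ) ℚ.≤ᵇ (μ A ⊚ μ A) x

    private
      a²Mⱼ>0 : 0 < a * a * Mⱼ
      a²Mⱼ>0 = *-pos a²>0 (M-pos j)

    unpopular-rep-small : ∀ z → not (popular z) ≡ true → 128 * rep A z * Mⱼ ≤ 127 * Mⱼ₊₁
    unpopular-rep-small z unpopular = ≮⇒≥ (λ 127Mⱼ₊₁<128rMⱼ → not≡true⇒¬T (popular z) unpopular
                                               (ℚ.≤⇒≤ᵇ (popular-if (<⇒≤ 127Mⱼ₊₁<128rMⱼ))))
      where
      not≡true⇒¬T : ∀ b → not b ≡ true → T b → ⊥
      not≡true⇒¬T true () _
      not≡true⇒¬T false _ ()
      popular-if : 127 * Mⱼ₊₁ ≤ 128 * rep A z * Mⱼ → (1ℚ ℚ.- frac 1 128) ℚ.* σ ℚ.≤ (μ A ⊚ μ A) z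
      popular-if 127Mⱼ₊₁≤128rMⱼ = subst₂ ℚ._≤_ (sym (frac-* {127} {128} {N * Mⱼ₊₁} z<s a²Mⱼ>0)) (sym (μ⊚μ-frac A A≢∅ z))
        (frac-≤ {127 * (N * Mⱼ₊₁)} {128 * (a * a * Mⱼ)} {rep A z * N} (*-pos {128} z<s a²Mⱼ>0) a²>0 (begin
          127 * (N * Mⱼ₊₁) * (a * a)          ≡⟨ regroup₁ N Mⱼ₊₁ (a * a) ⟩
          N * (a * a) * (127 * Mⱼ₊₁)          ≤⟨ *-monoʳ-≤ (N * (a * a)) 127Mⱼ₊₁≤128rMⱼ ⟩
          N * (a * a) * (128 * rep A z * Mⱼ)  ≡⟨ regroup₂ N (a * a) (rep A z) Mⱼ ⟩
          rep A z * N * (128 * (a * a * Mⱼ))  ∎))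
        where
        open ≤-Reasoning
        regroup₁ : ∀ N t x → 127 * (N * t) * x ≡ N * x * (127 * t)
        regroup₁ = solve-∀
        regroup₂ : ∀ N x r q → N * x * (128 * r * q) ≡ r * N * (128 * (x * q))
        regroup₂ = solve-∀

    few-unpopular : 2 ^ 9 * ∑ E (λ z → ⟦ not (popular z) ⟧ * rep A z ^ j) ≤ Mⱼ
    few-unpopular = *-cancelʳ-≤-pos ((127 * 257) ^ m) (^-pos m z<s) (begin
      2 ^ 9 * tail * (127 * 257) ^ m       ≡⟨ regroup tail (2 ^ 9) ((127 * 257) ^ m) ⟩
      tail * (2 ^ 9 * (127 * 257) ^ m)     ≤⟨ *-monoʳ-≤ tail m-decay ⟩
      tail * (128 * 256) ^ m               ≤⟨ tail-moment-bound (rep A) E (λ z → not (popular z)) {127} {128} {256} {257} {Mⱼ} {Mⱼ₊₁} {j₀} {m}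
                                                (M-pos j) unpopular-rep-small (slow-window-bound {256} {257} {m} {j₀} j₀-slow) ⟩
      (127 * 257) ^ m * Mⱼ                 ≡⟨ *-comm ((127 * 257) ^ m) Mⱼ ⟩
      Mⱼ * (127 * 257) ^ m                 ∎)
      where
      open ≤-Reasoning
      tail : ℕ
      tail = ∑ E (λ z → ⟦ not (popular z) ⟧ * rep A z ^ j)
      regroup : ∀ t c d → c * t * d ≡ t * (c * d)
      regroup = solve-∀

    private
      module Tuples = Averaging A j (λ z → not (popular z))

    tuple : Tuples.GoodTuple
    tuple = Tuples.good-tuple (M-pos (suc j)) (M-pos j) few-unpopular power-mean-at-j

    open Tuples.GoodTuple tuple

    B : Subset (suc k) n
    B = ⋂translates A s

    private
      b : ℕ
      b = card B

      b>0 : 0 < b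
      b>0 = positive-factor {y = b} {8 * N ^ j} large
        where
        positive-factor : ∀ {x y c} → x < c * y → 0 < y
        positive-factor {x} {ℕ.zero} {c} x<0 = contradiction (subst (x <_) (*-zeroʳ c) x<0) n≮0
        positive-factor {y = suc _} _ = z<s

      b²>0 : 0 < b * b
      b²>0 = *-pos b>0 b>0

    σ-lower : 1ℚ ℚ.+ frac 1 8 ℚ.≤ σ
    σ-lower = frac-≤ {9} {8} {N * Mⱼ₊₁} z<s a²Mⱼ>0 (begin
      9 * (a * a * Mⱼ)      ≡⟨ *-assoc 9 (a * a) Mⱼ ⟨
      9 * (a * a) * Mⱼ      ≤⟨ ratio-at-j ⟩
      8 * N * Mⱼ₊₁          ≡⟨ reverse 8 N Mⱼ₊₁ ⟩
      N * Mⱼ₊₁ * 8          ∎)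
      where
      open ≤-Reasoning
      reverse : ∀ x y z → x * y * z ≡ y * z * x
      reverse = solve-∀

    σ-upper : σ ℚ.≤ frac N a
    σ-upper = frac-≤ {N * Mⱼ₊₁} {a * a * Mⱼ} {N} a²Mⱼ>0 A≢∅ (begin
      N * Mⱼ₊₁ * a          ≤⟨ *-monoˡ-≤ a (*-monoʳ-≤ N (M-suc-≤ j)) ⟩
      N * (a * Mⱼ) * a      ≡⟨ regroup N a Mⱼ ⟩
      N * (a * a * Mⱼ)      ∎)
      where
      open ≤-Reasoning
      regroup : ∀ N a x → N * (a * x) * a ≡ N * (a * a * x)
      regroup = solve-∀

    density-lower : ∀ e → j + 20 ≤ e → density A ^ℚ e ℚ.≤ density B
    density-lower e j+20≤e = subst (ℚ._≤ density B) (sym (frac-^ {a} {N} e N>0))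
      (frac-≤ {a ^ e} {N ^ e} {b} {N} (^-pos e N>0) N>0 (density-amplification 9a≤8N large j+20≤e))

    popular-mass : 1ℚ ℚ.- frac 1 128 ℚ.≤ ⟨ 𝟙 popular , μ B ⊚ μ B ⟩
    popular-mass = subst (frac 127 128 ℚ.≤_) (sym ⟨𝟙,μ⊚μ⟩≡) (frac-≤ {127} {128} {pop * N} z<s (*-pos N>0 (*-pos {1} z<s b²>0)) (begin
      127 * (N * (1 * (b * b)))       ≡⟨ cong (λ x → 127 * (N * x)) (*-identityˡ (b * b)) ⟩
      127 * (N * (b * b))             ≡⟨ x∙yz≈y∙xz 127 N (b * b) ⟩
      N * (127 * (b * b))             ≡⟨ cong (λ x → N * (127 * x)) split ⟨
      N * (127 * (pop + unpop))       ≤⟨ *-monoʳ-≤ N (mostly-first {pop} {unpop} mostly-popular′) ⟩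
      N * (128 * pop)                 ≡⟨ regroup N pop ⟩
      pop * N * 128                   ∎))
      where
      open ≤-Reasoning
      pop unpop : ℕ
      pop = ∑ E (λ z → ⟦ popular z ⟧ * rep B z)
      unpop = Tuples.unpopular-rep s
      split : pop + unpop ≡ b * b
      split = trans (sym (∑-distrib-+ E _ _)) (trans (∑-cong E (λ z → ⟦⟧+⟦not⟧ (popular z) (rep B z))) (∑-rep B))
      mostly-popular′ : 128 * unpop ≤ pop + unpop
      mostly-popular′ = subst (128 * unpop ≤_) (sym split) mostly-popular
      mostly-first : ∀ {x y} → 128 * y ≤ x + y → 127 * (x + y) ≤ 128 * x
      mostly-first {x} {y} 128y≤x+y = begin
        127 * (x + y)       ≡⟨ *-distribˡ-+ 127 x y ⟩
        127 * x + 127 * y   ≤⟨ +-monoʳ-≤ (127 * x) (+-cancelʳ-≤ y (127 * y) x (subst (_≤ x + y) (split-128 y) 128y≤x+y)) ⟩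
        127 * x + x         ≡⟨ +-comm (127 * x) x ⟩
        128 * x             ∎
        where
        split-128 : ∀ y → 128 * y ≡ 127 * y + y
        split-128 = solve-∀
      regroup : ∀ N x → N * (128 * x) ≡ x * N * 128
      regroup = solve-∀
      ⟨𝟙,μ⊚μ⟩≡ : ⟨ 𝟙 popular , μ B ⊚ μ B ⟩ ≡ frac (pop * N) (N * (1 * (b * b)))
      ⟨𝟙,μ⊚μ⟩≡ = trans (𝔼-frac (*-pos {1} z<s b²>0) pointwise)
                        (cong (λ x → frac x (N * (1 * (b * b)))) (trans (∑-cong E (λ z → sym (*-assoc ⟦ popular z ⟧ (rep B z) N))) (∑-*ʳ E N _)))
        where
        pointwise : ∀ z → 𝟙 popular z ℚ.* (μ B ⊚ μ B) z ≡ frac (⟦ popular z ⟧ * (rep B z * N)) (1 * (b * b))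
        pointwise z = trans (cong₂ ℚ._*_ (𝟙-frac popular z) (μ⊚μ-frac B b>0 z)) (frac-* {⟦ popular z ⟧} {1} z<s b²>0)

    energy-upper : ⟨ μ A ⊚ μ A , μ B ⊚ μ B ⟩ ℚ.≤ frac 2 1 ℚ.* σ
    energy-upper = subst₂ ℚ._≤_ (sym ⟨μ⊚μ,μ⊚μ⟩≡) (sym (frac-* {2} {1} {N * Mⱼ₊₁} z<s a²Mⱼ>0))
      (frac-≤ {energy s * (N * N)} {N * (a * a * (b * b))} {2 * (N * Mⱼ₊₁)} (*-pos N>0 (*-pos a²>0 b²>0)) (*-pos {1} z<s a²Mⱼ>0) (begin
        energy s * (N * N) * (1 * (a * a * Mⱼ))      ≡⟨ regroup₁ (energy s) N (a * a) Mⱼ ⟩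
        Mⱼ * energy s * (N * N * (a * a))            ≤⟨ *-monoˡ-≤ (N * N * (a * a)) energy-bound ⟩
        2 * Mⱼ₊₁ * (b * b) * (N * N * (a * a))       ≡⟨ regroup₂ N Mⱼ₊₁ (a * a) (b * b) ⟩
        2 * (N * Mⱼ₊₁) * (N * (a * a * (b * b)))     ∎))
      where
      open ≤-Reasoning
      energy : Vec (G (suc k) n) j → ℕ
      energy = Tuples.energy
      regroup₁ : ∀ w N x q → w * (N * N) * (1 * (x * q)) ≡ q * w * (N * N * x)
      regroup₁ = solve-∀
      regroup₂ : ∀ N t x y → 2 * t * y * (N * N * x) ≡ 2 * (N * t) * (N * (x * y))
      regroup₂ = solve-∀
      ⟨μ⊚μ,μ⊚μ⟩≡ : ⟨ μ A ⊚ μ A , μ B ⊚ μ B ⟩ ≡ frac (energy s * (N * N)) (N * (a * a * (b * b)))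
      ⟨μ⊚μ,μ⊚μ⟩≡ = trans (𝔼-frac (*-pos a²>0 b²>0) pointwise)
                         (cong (λ x → frac x (N * (a * a * (b * b)))) (trans (∑-cong E (λ z → interchange′ (rep A z) N (rep B z))) (∑-*ʳ E (N * N) _)))
        where
        interchange′ : ∀ x N y → x * N * (y * N) ≡ x * y * (N * N)
        interchange′ = solve-∀
        pointwise : ∀ z → (μ A ⊚ μ A) z ℚ.* (μ B ⊚ μ B) z ≡ frac (rep A z * N * (rep B z * N)) (a * a * (b * b))
        pointwise z = trans (cong₂ ℚ._*_ (μ⊚μ-frac A A≢∅ z) (μ⊚μ-frac B b>0 z)) (frac-* {rep A z * N} {a * a} a²>0 b²>0)


open import Defs
open import Data.Nat using (ℕ; _≥_; _>_; _+_; _*_)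
open import Data.Nat.Primality using (Prime)
open import Data.Bool using (true; false)
open import Data.Product using (Σ; ∃; ∃-syntax; _×_; _,_)
open import Data.Rational using (ℚ; _≤_; _≤ᵇ_; 1ℚ; _-_)
open import Data.Rational using () renaming (_*_ to _*ℚ_; _+_ to _+ℚ_)
open import Data.Rational.Literals using ()
open import Data.Nat using (zero; suc; z<s)
open import Data.Nat.Properties using (≤-refl)

lemma3p3 : ∃[ C ] (C > 0 × (∀ (q n p : ℕ) → Prime q → q ≥ 3 → n ≥ 1 → p ≥ 1 →
    (A : Subset q n) → card A > 0 →
    (1ℚ +ℚ frac 1 8) ^ p ≤ powMean (μ A ⊚ μ A) p →
    ∃[ σ ] ∃[ A₁ ] ∃[ A₂ ]
      ((1ℚ +ℚ frac 1 8) ≤ σ × σ ≤ frac (size q n) (card A)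
      × density A ^ (C * (p + Lceil A)) ≤ density A₁
      × density A ^ (C * (p + Lceil A)) ≤ density A₂
      × (1ℚ - frac 1 128) ≤ ⟨ 𝟙 (λ x → ((1ℚ - frac 1 128) *ℚ σ) ≤ᵇ (μ A ⊚ μ A) x) , μ A₁ ⊚ μ A₂ ⟩
      × ⟨ μ A ⊚ μ A , μ A₁ ⊚ μ A₁ ⟩ ≤ frac 2 1 *ℚ σ
      × ⟨ μ A ⊚ μ A , μ A₂ ⊚ μ A₂ ⟩ ≤ frac 2 1 *ℚ σ)))
lemma3p3 = 2097152 , z<s , λ where
  (suc k) n (suc p′) _ _ _ _ A A≢∅ hyp →
    let open Construction.Structure p′ A A≢∅ hyp 2048 Construction.2^9*[127*257]^2048≤[128*256]^2048 in
    σ , B , B , σ-lower , σ-upper ,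
    density-lower (2097152 * (suc p′ + Lceil A)) (j+20≤ ≤-refl) ,
    density-lower (2097152 * (suc p′ + Lceil A)) (j+20≤ ≤-refl) ,
    popular-mass , energy-upper , energy-upper
  zero _ _ _ () _ _ _ _ _
  (suc _) _ zero _ _ _ () _ _ _
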